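{- Let $G$ be an $n$-vertex graph with maximum degree $\Delta := \Delta(n)$, let $\mathcal{L} = \{L(v) : v \in V(G)\}$ be a random $(k,m)$-list-assignment, where $m \geq 3 k^2 \Delta$, and let $B := B(G, \mathcal{L})$ be the graph of dangerous edges. Then, a.a.s. (as $n \to \infty$) every connected component of $B$ has at most $20 \log n$ vertices.
   Context: A random $(k,m)$-list-assignment assigns to each vertex $v$ independently a uniformly random $k$-subset $L(v)$ of $\{1,\ldots,m\}$. An edge $uv \in E(G)$ is dangerous (with respect to $\mathcal{L}$) if $L(u) \cap L(v) \neq \emptyset$; $B(G,\mathcal{L})$ is the spanning subgraph of $G$ consisting of the dangerous edges. $\log$ is the natural logarithm. -}

module Defs where

open import Data.Nat using (ℕ; zero; suc; _+_; _*_; _^_; _≤_; _⊔_; _!)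
open import Data.Nat.Combinatorics using (_C_)
open import Data.Bool using (Bool; true; false)
open import Data.Fin using (Fin)
open import Data.Fin.Subset using (Subset; _∈_; ∣_∣)
open import Data.Vec using (Vec; lookup; tabulate)
open import Data.List using (List; map; foldr; allFin)
open import Data.Product using (_×_; ∃-syntax)
open import Relation.Binary.PropositionalEquality using (_≡_)

record Graph (n : ℕ) : Set where
  field
    adj    : Fin n → Fin n → Bool
    sym    : ∀ u v → adj u v ≡ adj v u
    irrefl : ∀ v → adj v v ≡ false
open Graph public

degree : ∀ {n} → Graph n → Fin n → ℕ
degree G v = ∣ tabulate (adj G v) ∣

maxDegree : ∀ {n} → Graph n → ℕ
maxDegree {n} G = foldr _⊔_ 0 (map (degree G) (allFin n))

-- A list-assignment: vertex v gets the subset L(v) of {1..m} (encoded as Fin m).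
ListAssignment : ℕ → ℕ → Set
ListAssignment n m = Vec (Subset m) n

IsKList : ∀ {n m} → ℕ → ListAssignment n m → Set
IsKList k L = ∀ v → ∣ lookup L v ∣ ≡ k

Dangerous : ∀ {n m} → Graph n → ListAssignment n m → Fin n → Fin n → Set
Dangerous G L u v = (adj G u v ≡ true) × ∃[ c ] (c ∈ lookup L u × c ∈ lookup L v)

data Reach {n m} (G : Graph n) (L : ListAssignment n m) : Fin n → Fin n → Set where
  here : ∀ {v} → Reach G L v v
  step : ∀ {u w v} → Dangerous G L u w → Reach G L w v → Reach G L u v

-- Scaled exponential partial sums: expPS c j = j! * Σ_{i ≤ j} c^i / i!
expPS : ℕ → ℕ → ℕ
expPS c zero    = 1
expPS c (suc j) = suc j * expPS c j + c ^ suc j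

-- ExpLe c N  means  e^c ≤ N  (all partial sums of the exponential series are ≤ N).
ExpLe : ℕ → ℕ → Set
ExpLe c N = ∀ j → expPS c j ≤ N * (j !)

-- Every connected component of B(G,L) has at most 20 log n vertices:
-- every set S of vertices inside the component of v has e^{|S|} ≤ n^20,
-- i.e. |S| ≤ 20 ln n.
ComponentsSmall : ∀ {n m} → Graph n → ListAssignment n m → Set
ComponentsSmall {n} G L =
  ∀ v (S : Subset n) → (∀ u → u ∈ S → Reach G L v u) → ExpLe ∣ S ∣ (n ^ 20)

-- Let c ≈ 11 log₂ n. Explore the component of v in B(G, L) from v, scanning the (at most Δ)
-- neighbours of each vertex in turn and stopping after c new vertices. If the search finds c
-- edges, it has found a tree on c + 1 vertices along which all lists meet, and it is recorded
-- by a string of (c + 1) Δ bits with c ones from which G alone reconstructs the tree. So the bad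
-- assignments lie in a union over n roots and C((c + 1) Δ, c) codes, and a fixed tree has all
-- its lists meeting with probability at most (k²/m)^c ≤ (3Δ)^-c. As C((c + 1) Δ, c) ≤ ((c + 1) Δ)^c / c!
-- and c^c ≤ (14/5)^c c!, the union has probability about n (14/15)^c ≤ 1/(q + 1). If the search
-- stops early, the component has at most c vertices, and e^c ≤ n^20 since 11/ln 2 < 20.

module Submission where

open import Data.Bool.Base using (Bool; true; false; T; not; _∧_; if_then_else_)
open import Data.Bool.Properties using (∧-zeroʳ)
open import Data.Fin.Base using (Fin; zero; suc; toℕ; fromℕ<)
open import Data.Fin.Properties using (all?; toℕ-fromℕ<) renaming (_≟_ to _≟ᶠ_)
open import Data.Fin.Subset using (Subset; inside; outside; ∣_∣; ⊥; ∁; _∩_; _⊆_; Nonempty)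
  renaming (_∈_ to _∈ₛ_; _∉_ to _∉ₛ_)
open import Data.Fin.Subset.Properties
  using (∣⊥∣≡0; ∉⊥; ∣p∣≤n; ∣∁p∣≡n∸∣p∣; p⊆q⇒∣p∣≤∣q∣; nonempty?; x∈p∩q⁺)
  renaming (_∈?_ to _∈ₛ?_)
open import Data.List.Base as List
  using ( List; []; _∷_; [_]; _++_; map; concatMap; length; filter; allFin; foldr; replicate
        ; cartesianProduct; cartesianProductWith)
open import Data.List.Properties
  using (length-++; length-map; length-replicate; length-tabulate; map-++; ++-assoc)
open import Data.List.Membership.Propositional using (_∈_; _∉_; lose)
open import Data.List.Membership.Propositional.Properties
  using ( ∈-map⁺; ∈-++⁺ˡ; ∈-++⁺ʳ; ∈-++⁻; ∈-concatMap⁺; ∈-cartesianProduct⁺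
        ; ∈-cartesianProductWith⁺; ∈-filter⁺; ∈-allFin)
open import Data.List.Relation.Unary.Any using (here; there)
open import Data.List.Relation.Unary.Any.Properties using (¬Any[])
open import Data.Nat.Base
  using (ℕ; zero; suc; _+_; _*_; _^_; _∸_; _≤_; _<_; _⊔_; _!; z≤n; s≤s; pred; NonZero; >-nonZero)
open import Data.Nat.Properties
open import Data.Nat.Combinatorics using (_C_; nC1≡n; nCk+nC[k+1]≡[n+1]C[k+1])
open import Data.Nat.Tactic.RingSolver using (solve-∀)
open import Data.Product using (Σ; ∃; ∃-syntax; _×_; _,_; proj₁; proj₂; map₁; uncurry)
open import Data.Sum using (_⊎_; inj₁; inj₂)
import Data.Sum as Sum
open import Data.Vec.Base
  using ([]; _∷_; lookup; tabulate; _[_]≔_; here; there; toList; fromList)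
open import Data.Vec.Properties
  using ( []≔-updates; []≔-minimal; lookup⇒[]=; []=⇒lookup; tabulate-cong; tabulate∘lookup
        ; lookup∘tabulate; lookup∘update; lookup∘update′; toList∘fromList)
open import Function.Base using (_∘_)
open import Relation.Binary.PropositionalEquality hiding ([_])
open import Relation.Nullary using (Dec; yes; no; ¬_; contradiction)
open import Relation.Nullary.Decidable using (T?; ¬?; _×-dec_; toWitness)
import Algebra.Properties.CommutativeSemigroup as CommSemigroupProperties
open import Defs hiding (sym)

open CommSemigroupProperties *-commutativeSemigroup using (x∙yz≈y∙xz)
open ≤-Reasoning

^-distribʳ-* : ∀ m n k → (m * n) ^ k ≡ m ^ k * n ^ k
^-distribʳ-* m n zero    = refl
^-distribʳ-* m n (suc k) = trans (cong (m * n *_) (^-distribʳ-* m n k)) (interchange m n (m ^ k) (n ^ k))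
  where
  interchange : ∀ a b x y → a * b * (x * y) ≡ a * x * (b * y)
  interchange = solve-∀

-- A Stirling-type bound

bernoulli : ∀ a k → a ^ suc k + suc k * a ^ k ≤ suc a ^ suc k
bernoulli a zero    = ≤-reflexive (identity a)
  where
  identity : ∀ a → a * 1 + 1 * 1 ≡ (1 + a) * 1
  identity = solve-∀
bernoulli a (suc k) = begin
  a ^ (2 + k) + (2 + k) * a ^ suc k                    ≤⟨ m≤m+n _ (suc k * a ^ k) ⟩
  a ^ (2 + k) + (2 + k) * a ^ suc k + suc k * a ^ k    ≡⟨ factor a (a ^ k) k ⟩
  suc a * (a ^ suc k + suc k * a ^ k)                  ≤⟨ *-monoʳ-≤ (suc a) (bernoulli a k) ⟩
  suc a ^ (2 + k)                                      ∎
  where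
  factor : ∀ a x k → a * (a * x) + (2 + k) * (a * x) + (1 + k) * x ≡ (1 + a) * (a * x + (1 + k) * x)
  factor = solve-∀

-- (1 + 1/w)^(1 + w) decreases in w: write (2 + w) w = A and (1 + w)² = 1 + A, then use Bernoulli for 1 + A.
euler-upper-decreasing : ∀ w → (2 + w) ^ (2 + w) * w ^ (1 + w) ≤ (1 + w) ^ (3 + 2 * w)
euler-upper-decreasing w = begin
  (2 + w) ^ (2 + w) * w ^ (1 + w)              ≡⟨ *-assoc (2 + w) ((2 + w) ^ (1 + w)) (w ^ (1 + w)) ⟩
  (2 + w) * ((2 + w) ^ (1 + w) * w ^ (1 + w))  ≡⟨ cong ((2 + w) *_) (^-distribʳ-* (2 + w) w (1 + w)) ⟨
  (2 + w) * A ^ (1 + w)                        ≡⟨ split w (A ^ w) ⟩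
  (1 + w) * A ^ (1 + w) + A * A ^ w            ≤⟨ +-monoʳ-≤ ((1 + w) * A ^ (1 + w)) (*-monoˡ-≤ (A ^ w) (n≤1+n A)) ⟩
  (1 + w) * A ^ (1 + w) + suc A * A ^ w        ≡⟨ cong (λ x → (1 + w) * A ^ (1 + w) + x * A ^ w) (square w) ⟩
  (1 + w) * A ^ (1 + w) + (1 + w) * (1 + w) * A ^ w
                                               ≡⟨ collect w (A ^ (1 + w)) (A ^ w) ⟩
  (1 + w) * (A ^ (1 + w) + (1 + w) * A ^ w)    ≤⟨ *-monoʳ-≤ (1 + w) (bernoulli A w) ⟩
  (1 + w) * suc A ^ (1 + w)                    ≡⟨ cong (λ x → (1 + w) * x ^ (1 + w)) (square w) ⟩
  (1 + w) * ((1 + w) * (1 + w)) ^ (1 + w)      ≡⟨ cong ((1 + w) *_) (^-distribʳ-* (1 + w) (1 + w) (1 + w)) ⟩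
  (1 + w) * ((1 + w) ^ (1 + w) * (1 + w) ^ (1 + w))
                                               ≡⟨ cong ((1 + w) *_) (^-distribˡ-+-* (1 + w) (1 + w) (1 + w)) ⟨
  (1 + w) ^ (1 + ((1 + w) + (1 + w)))          ≡⟨ cong ((1 + w) ^_) (exponent w) ⟩
  (1 + w) ^ (3 + 2 * w)                        ∎
  where
  A = (2 + w) * w
  square : ∀ w → 1 + (2 + w) * w ≡ (1 + w) * (1 + w)
  square = solve-∀
  split : ∀ w x → (2 + w) * ((2 + w) * w * x) ≡ (1 + w) * ((2 + w) * w * x) + (2 + w) * w * x
  split = solve-∀
  collect : ∀ w y x → (1 + w) * y + (1 + w) * (1 + w) * x ≡ (1 + w) * (y + (1 + w) * x)
  collect = solve-∀
  exponent : ∀ w → 1 + ((1 + w) + (1 + w)) ≡ 3 + 2 * w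
  exponent = solve-∀

EulerUpper : ℕ → Set
EulerUpper w = 5 * (1 + w) ^ (1 + w) ≤ 14 * w ^ (1 + w)

euler-upper-step : ∀ w → .{{NonZero w}} → EulerUpper w → EulerUpper (suc w)
euler-upper-step w bound = *-cancelʳ-≤ _ _ (w ^ (1 + w)) {{m^n≢0 w (1 + w)}} (begin
  5 * (2 + w) ^ (2 + w) * w ^ (1 + w)         ≡⟨ *-assoc 5 ((2 + w) ^ (2 + w)) (w ^ (1 + w)) ⟩
  5 * ((2 + w) ^ (2 + w) * w ^ (1 + w))       ≤⟨ *-monoʳ-≤ 5 (euler-upper-decreasing w) ⟩
  5 * (1 + w) ^ (3 + 2 * w)                   ≡⟨ cong (λ e → 5 * (1 + w) ^ e) (exponent w) ⟩
  5 * (1 + w) ^ ((1 + w) + (2 + w))           ≡⟨ cong (5 *_) (^-distribˡ-+-* (1 + w) (1 + w) (2 + w)) ⟩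
  5 * ((1 + w) ^ (1 + w) * (1 + w) ^ (2 + w)) ≡⟨ *-assoc 5 ((1 + w) ^ (1 + w)) ((1 + w) ^ (2 + w)) ⟨
  5 * (1 + w) ^ (1 + w) * (1 + w) ^ (2 + w)   ≤⟨ *-monoˡ-≤ ((1 + w) ^ (2 + w)) bound ⟩
  14 * w ^ (1 + w) * (1 + w) ^ (2 + w)        ≡⟨ swap (w ^ (1 + w)) ((1 + w) ^ (2 + w)) ⟩
  14 * (1 + w) ^ (2 + w) * w ^ (1 + w)        ∎)
  where
  exponent : ∀ w → 3 + 2 * w ≡ (1 + w) + (2 + w)
  exponent = solve-∀
  swap : ∀ x y → 14 * x * y ≡ 14 * y * x
  swap = solve-∀

euler-upper-bound : ∀ w → 20 ≤ w → EulerUpper w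
euler-upper-bound (suc w) 20≤1+w with 20 ≟ suc w
... | yes 20≡1+w = subst EulerUpper 20≡1+w (≤ᵇ⇒≤ _ _ _)
... | no  20≢1+w = euler-upper-step w {{>-nonZero (≤-trans (s≤s z≤n) 20≤w)}} (euler-upper-bound w 20≤w)
  where
  20≤w : 20 ≤ w
  20≤w = ≤-pred (≤∧≢⇒< 20≤1+w 20≢1+w)

EulerBound : ℕ → Set
EulerBound c = 5 * (1 + c) ^ c ≤ 14 * c ^ c

euler-bound : ∀ c → EulerBound c
euler-bound c with c <? 20
... | yes c<20 = subst EulerBound (toℕ-fromℕ< c<20) (below-20 (fromℕ< c<20))
  where
  below-20 : ∀ (i : Fin 20) → EulerBound (toℕ i)
  below-20 = toWitness {a? = all? λ i → 5 * (1 + toℕ i) ^ toℕ i ≤? 14 * toℕ i ^ toℕ i} _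
... | no  c≮20 = *-cancelʳ-≤ _ _ (1 + c) (begin
    5 * (1 + c) ^ c * (1 + c)  ≡⟨ rotate 5 (1 + c) ((1 + c) ^ c) ⟩
    5 * (1 + c) ^ (1 + c)      ≤⟨ euler-upper-bound c (≮⇒≥ c≮20) ⟩
    14 * c ^ (1 + c)           ≡⟨ rotate 14 c (c ^ c) ⟨
    14 * c ^ c * c             ≤⟨ *-monoʳ-≤ (14 * c ^ c) (n≤1+n c) ⟩
    14 * c ^ c * (1 + c)       ∎)
  where
  rotate : ∀ a b x → a * x * b ≡ a * (b * x)
  rotate = solve-∀

stirling : ∀ c → 5 ^ c * c ^ c ≤ 14 ^ c * c !
stirling zero    = ≤-refl
stirling (suc c) = begin
  5 ^ suc c * suc c ^ suc c            ≡⟨ regroup (5 ^ c) (suc c) (suc c ^ c) ⟩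
  suc c * (5 * suc c ^ c * 5 ^ c)      ≤⟨ *-monoʳ-≤ (suc c) (*-monoˡ-≤ (5 ^ c) (euler-bound c)) ⟩
  suc c * (14 * c ^ c * 5 ^ c)         ≡⟨ cong (suc c *_) (regroup′ (c ^ c) (5 ^ c)) ⟩
  suc c * (14 * (5 ^ c * c ^ c))       ≤⟨ *-monoʳ-≤ (suc c) (*-monoʳ-≤ 14 (stirling c)) ⟩
  suc c * (14 * (14 ^ c * c !))        ≡⟨ regroup″ (suc c) (14 ^ c) (c !) ⟩
  14 ^ suc c * suc c !                 ∎
  where
  regroup : ∀ x u y → 5 * x * (u * y) ≡ u * (5 * y * x)
  regroup = solve-∀
  regroup′ : ∀ y x → 14 * y * x ≡ 14 * (x * y)
  regroup′ = solve-∀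
  regroup″ : ∀ u x f → u * (14 * (x * f)) ≡ 14 * x * (u * f)
  regroup″ = solve-∀

-- Partial sums of the exponential series

[i+d]!≤i!*[i+d]^d : ∀ i d → (i + d) ! ≤ i ! * (i + d) ^ d
[i+d]!≤i!*[i+d]^d i zero    rewrite +-identityʳ i | *-identityʳ (i !) = ≤-refl
[i+d]!≤i!*[i+d]^d i (suc d) rewrite +-suc i d = begin
  suc (i + d) * (i + d) !                  ≤⟨ *-monoʳ-≤ (suc (i + d)) ([i+d]!≤i!*[i+d]^d i d) ⟩
  suc (i + d) * (i ! * (i + d) ^ d)        ≤⟨ *-monoʳ-≤ (suc (i + d)) (*-monoʳ-≤ (i !) (^-monoˡ-≤ d (n≤1+n _))) ⟩
  suc (i + d) * (i ! * suc (i + d) ^ d)    ≡⟨ x∙yz≈y∙xz (suc (i + d)) (i !) _ ⟩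
  i ! * (suc (i + d) * suc (i + d) ^ d)    ∎

c^d*c!≤[c+d]! : ∀ c d → c ^ d * c ! ≤ (c + d) !
c^d*c!≤[c+d]! c zero    rewrite +-identityʳ c | +-identityʳ (c !) = ≤-refl
c^d*c!≤[c+d]! c (suc d) rewrite +-suc c d = begin
  c * c ^ d * c !          ≡⟨ *-assoc c _ _ ⟩
  c * (c ^ d * c !)        ≤⟨ *-mono-≤ (≤-trans (m≤m+n c d) (n≤1+n (c + d))) (c^d*c!≤[c+d]! c d) ⟩
  suc (c + d) * (c + d) !  ∎

c^i*c!≤c^c*i! : ∀ c i → c ^ i * c ! ≤ c ^ c * i !
c^i*c!≤c^c*i! c i with ≤-total i c
... | inj₁ i≤c = begin
  c ^ i * c !                ≡⟨ cong (λ x → c ^ i * x !) (sym i+d≡c) ⟩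
  c ^ i * (i + d) !          ≤⟨ *-monoʳ-≤ (c ^ i) ([i+d]!≤i!*[i+d]^d i d) ⟩
  c ^ i * (i ! * (i + d) ^ d) ≡⟨ cong (λ x → c ^ i * (i ! * x ^ d)) i+d≡c ⟩
  c ^ i * (i ! * c ^ d)      ≡⟨ regroup (c ^ i) (i !) (c ^ d) ⟩
  c ^ i * c ^ d * i !        ≡⟨ cong (_* i !) (^-distribˡ-+-* c i d) ⟨
  c ^ (i + d) * i !          ≡⟨ cong (λ x → c ^ x * i !) i+d≡c ⟩
  c ^ c * i !                ∎
  where
  d = c ∸ i
  i+d≡c = m+[n∸m]≡n i≤c
  regroup : ∀ a b x → a * (b * x) ≡ a * x * b
  regroup = solve-∀
... | inj₂ c≤i = begin
  c ^ i * c !                ≡⟨ cong (λ x → c ^ x * c !) (sym c+d≡i) ⟩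
  c ^ (c + d) * c !          ≡⟨ cong (_* c !) (^-distribˡ-+-* c c d) ⟩
  c ^ c * c ^ d * c !        ≡⟨ *-assoc (c ^ c) _ _ ⟩
  c ^ c * (c ^ d * c !)      ≤⟨ *-monoʳ-≤ (c ^ c) (c^d*c!≤[c+d]! c d) ⟩
  c ^ c * (c + d) !          ≡⟨ cong (λ x → c ^ c * x !) c+d≡i ⟩
  c ^ c * i !                ∎
  where
  d = i ∸ c
  c+d≡i = m+[n∸m]≡n c≤i

c!*expPS≤[1+j]*c^c*j! : ∀ c j → c ! * expPS c j ≤ suc j * c ^ c * j !
c!*expPS≤[1+j]*c^c*j! c zero    = begin
  c ! * 1        ≡⟨ *-identityʳ (c !) ⟩
  c !            ≡⟨ *-identityˡ (c !) ⟨
  c ^ 0 * c !    ≤⟨ c^i*c!≤c^c*i! c 0 ⟩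
  c ^ c * 1      ≡⟨ cong (_* 1) (+-identityʳ (c ^ c)) ⟨
  1 * c ^ c * 1  ∎
c!*expPS≤[1+j]*c^c*j! c (suc j) = begin
  c ! * (suc j * expPS c j + c ^ suc j)                ≡⟨ expand (c !) (suc j) (expPS c j) (c ^ suc j) ⟩
  suc j * (c ! * expPS c j) + c ^ suc j * c !          ≤⟨ +-mono-≤ (*-monoʳ-≤ (suc j) (c!*expPS≤[1+j]*c^c*j! c j))
                                                                  (c^i*c!≤c^c*i! c (suc j)) ⟩
  suc j * (suc j * c ^ c * j !) + c ^ c * (suc j * j !) ≡⟨ collect (suc j) (c ^ c) (j !) ⟩
  suc (suc j) * c ^ c * (suc j * j !)                  ∎
  where
  expand : ∀ f a e p → f * (a * e + p) ≡ a * (f * e) + p * f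
  expand = solve-∀
  collect : ∀ a x f → a * (a * x * f) + x * (a * f) ≡ (1 + a) * x * (a * f)
  collect = solve-∀

-- Beyond 2c each term is at most half the previous one, so the tail is at most twice the last term.
expPS-tail : ∀ c d → c ! * (expPS c (2 * c + d) + 2 * c ^ (2 * c + d)) ≤ (2 * c + 3) * c ^ c * (2 * c + d) !
expPS-tail c zero rewrite +-identityʳ (2 * c) = begin
  c ! * (expPS c (2 * c) + 2 * c ^ (2 * c))                ≡⟨ *-distribˡ-+ (c !) _ _ ⟩
  c ! * expPS c (2 * c) + c ! * (2 * c ^ (2 * c))          ≤⟨ +-mono-≤ (c!*expPS≤[1+j]*c^c*j! c (2 * c))
                                                                      (≤-trans (≤-reflexive (swap (c !) (c ^ (2 * c))))
                                                                               (*-monoʳ-≤ 2 (c^i*c!≤c^c*i! c (2 * c)))) ⟩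
  suc (2 * c) * c ^ c * (2 * c) ! + 2 * (c ^ c * (2 * c) !) ≡⟨ collect c (c ^ c) ((2 * c) !) ⟩
  (2 * c + 3) * c ^ c * (2 * c) !                          ∎
  where
  swap : ∀ f x → f * (2 * x) ≡ 2 * (x * f)
  swap = solve-∀
  collect : ∀ c x f → (1 + 2 * c) * x * f + 2 * (x * f) ≡ (2 * c + 3) * x * f
  collect = solve-∀
expPS-tail c (suc d) rewrite +-suc (2 * c) d = begin
  c ! * (suc j * expPS c j + c ^ suc j + 2 * (c * c ^ j)) ≡⟨ expand (c !) (suc j) (expPS c j) c (c ^ j) ⟩
  c ! * (suc j * expPS c j) + c ! * (3 * c * c ^ j)       ≤⟨ +-monoʳ-≤ (c ! * (suc j * expPS c j))
                                                                        (*-monoʳ-≤ (c !) (*-monoˡ-≤ (c ^ j) 3c≤2[1+j])) ⟩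
  c ! * (suc j * expPS c j) + c ! * (2 * suc j * c ^ j)   ≡⟨ collect (c !) (suc j) (expPS c j) (c ^ j) ⟩
  suc j * (c ! * (expPS c j + 2 * c ^ j))                 ≤⟨ *-monoʳ-≤ (suc j) (expPS-tail c d) ⟩
  suc j * ((2 * c + 3) * c ^ c * j !)                     ≡⟨ x∙yz≈y∙xz (suc j) ((2 * c + 3) * c ^ c) (j !) ⟩
  (2 * c + 3) * c ^ c * (suc j * j !)                     ∎
  where
  j = 2 * c + d
  3c≤2[1+j] : 3 * c ≤ 2 * suc j
  3c≤2[1+j] = ≤-trans (m≤m+n (3 * c) (c + 2 + 2 * d)) (≤-reflexive (identity c d))
    where
    identity : ∀ c d → 3 * c + (c + 2 + 2 * d) ≡ 2 * (1 + (2 * c + d))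
    identity = solve-∀
  expand : ∀ f a e c x → f * (a * e + c * x + 2 * (c * x)) ≡ f * (a * e) + f * (3 * c * x)
  expand = solve-∀
  collect : ∀ f a e x → f * (a * e) + f * (2 * a * x) ≡ a * (f * (e + 2 * x))
  collect = solve-∀

c!*expPS≤[2c+3]*c^c*j! : ∀ c j → c ! * expPS c j ≤ (2 * c + 3) * c ^ c * j !
c!*expPS≤[2c+3]*c^c*j! c j with ≤-total j (2 * c)
... | inj₁ j≤2c = ≤-trans (c!*expPS≤[1+j]*c^c*j! c j) (*-monoˡ-≤ (j !) (*-monoˡ-≤ (c ^ c) 1+j≤2c+3))
  where
  1+j≤2c+3 : suc j ≤ 2 * c + 3
  1+j≤2c+3 = ≤-trans (s≤s j≤2c) (≤-trans (≤-reflexive (+-comm 1 (2 * c))) (+-monoʳ-≤ (2 * c) (s≤s z≤n)))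
... | inj₂ 2c≤j = begin
  c ! * expPS c j                                   ≡⟨ cong (λ x → c ! * expPS c x) (sym 2c+d≡j) ⟩
  c ! * expPS c (2 * c + d)                         ≤⟨ *-monoʳ-≤ (c !) (m≤m+n _ _) ⟩
  c ! * (expPS c (2 * c + d) + 2 * c ^ (2 * c + d)) ≤⟨ expPS-tail c d ⟩
  (2 * c + 3) * c ^ c * (2 * c + d) !               ≡⟨ cong (λ x → (2 * c + 3) * c ^ c * x !) 2c+d≡j ⟩
  (2 * c + 3) * c ^ c * j !                         ∎
  where
  d = j ∸ 2 * c
  2c+d≡j = m+[n∸m]≡n 2c≤j

expLe-from : ∀ c N → (2 * c + 3) * c ^ c ≤ N * c ! → ExpLe c N
expLe-from c N bound j = *-cancelˡ-≤ (c !) {{c !≢0}} (begin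
  c ! * expPS c j            ≤⟨ c!*expPS≤[2c+3]*c^c*j! c j ⟩
  (2 * c + 3) * c ^ c * j !  ≤⟨ *-monoˡ-≤ (j !) bound ⟩
  N * c ! * j !              ≡⟨ regroup N (c !) (j !) ⟩
  c ! * (N * j !)            ∎)
  where
  regroup : ∀ a b x → a * b * x ≡ b * (a * x)
  regroup = solve-∀

expPS-monoˡ-≤ : ∀ {a b} → a ≤ b → ∀ j → expPS a j ≤ expPS b j
expPS-monoˡ-≤ a≤b zero    = ≤-refl
expPS-monoˡ-≤ a≤b (suc j) = +-mono-≤ (*-monoʳ-≤ (suc j) (expPS-monoˡ-≤ a≤b j)) (^-monoˡ-≤ (suc j) a≤b)

expLe-mono : ∀ {a b N} → a ≤ b → ExpLe b N → ExpLe a N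
expLe-mono a≤b e^b≤N j = ≤-trans (expPS-monoˡ-≤ a≤b j) (e^b≤N j)

-- Choice of c

x+x≡2*x : ∀ x → x + x ≡ 2 * x
x+x≡2*x x = cong (x +_) (sym (+-identityʳ x))

binary-log : ∀ n → 1 ≤ n → ∃[ ℓ ] (2 ^ ℓ ≤ n × n < 2 ^ suc ℓ)
binary-log (suc zero)    _ = 0 , ≤-refl , ≤-refl
binary-log (suc (suc n)) _ with binary-log (suc n) (s≤s z≤n)
... | ℓ , 2^ℓ≤1+n , 1+n<2^[1+ℓ] with suc (suc n) <? 2 ^ suc ℓ
...   | yes 2+n<2^[1+ℓ] = ℓ , ≤-trans 2^ℓ≤1+n (n≤1+n _) , 2+n<2^[1+ℓ]
...   | no  2+n≮2^[1+ℓ] = suc ℓ , ≤-reflexive (sym 2+n≡2^[1+ℓ]) , 2+n<2^[2+ℓ]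
  where
  2+n≡2^[1+ℓ] : suc (suc n) ≡ 2 ^ suc ℓ
  2+n≡2^[1+ℓ] = ≤-antisym 1+n<2^[1+ℓ] (≮⇒≥ 2+n≮2^[1+ℓ])
  2+n<2^[2+ℓ] : suc (suc n) < 2 ^ suc (suc ℓ)
  2+n<2^[2+ℓ] = begin-strict
    suc (suc n)            ≡⟨ 2+n≡2^[1+ℓ] ⟩
    2 ^ suc ℓ              <⟨ m<m+n (2 ^ suc ℓ) (m^n>0 2 (suc ℓ)) ⟩
    2 ^ suc ℓ + 2 ^ suc ℓ  ≡⟨ x+x≡2*x (2 ^ suc ℓ) ⟩
    2 ^ suc (suc ℓ)        ∎

n<2^n : ∀ n → n < 2 ^ n
n<2^n zero    = s≤s z≤n
n<2^n (suc n) = ≤-trans (+-mono-≤ (m^n>0 2 n) (n<2^n n)) (≤-reflexive (x+x≡2*x (2 ^ n)))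

threshold : ℕ → ℕ → ℕ
threshold q ℓ = 11 * (ℓ + (3 + q))

1≤threshold : ∀ q ℓ → 1 ≤ threshold q ℓ
1≤threshold q ℓ = *-mono-≤ {1} {11} (s≤s z≤n) (≤-trans (s≤s z≤n) (m≤n+m (3 + q) ℓ))

-- Since 2 · 14¹¹ ≤ 15¹¹, the factor (15/14)^c is at least 2^(ℓ + 3 + q) > 4 (q + 1) n.
n*14^[1+c]≤5*15^c : ∀ q ℓ n → n < 2 ^ suc ℓ →
  let c = threshold q ℓ in suc q * n * 14 * 14 ^ c ≤ 5 * 15 ^ c
n*14^[1+c]≤5*15^c q ℓ n n<2^[1+ℓ] = begin
  suc q * n * 14 * 14 ^ c      ≤⟨ *-monoˡ-≤ (14 ^ c) n*14≤5*2^t ⟩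
  5 * 2 ^ t * 14 ^ c           ≡⟨ *-assoc 5 (2 ^ t) (14 ^ c) ⟩
  5 * (2 ^ t * 14 ^ c)         ≡⟨ cong (λ x → 5 * (2 ^ t * x)) (^-*-assoc 14 11 t) ⟨
  5 * (2 ^ t * (14 ^ 11) ^ t)  ≡⟨ cong (5 *_) (^-distribʳ-* 2 (14 ^ 11) t) ⟨
  5 * (2 * 14 ^ 11) ^ t        ≤⟨ *-monoʳ-≤ 5 (^-monoˡ-≤ t (≤ᵇ⇒≤ (2 * 14 ^ 11) (15 ^ 11) _)) ⟩
  5 * (15 ^ 11) ^ t            ≡⟨ cong (5 *_) (^-*-assoc 15 11 t) ⟩
  5 * 15 ^ c                   ∎
  where
  t = ℓ + (3 + q)
  c = 11 * t
  n*14≤5*2^t : suc q * n * 14 ≤ 5 * 2 ^ t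
  n*14≤5*2^t = begin
    suc q * n * 14                         ≤⟨ *-monoˡ-≤ 14 (*-mono-≤ (n<2^n q) (<⇒≤ n<2^[1+ℓ])) ⟩
    2 ^ q * (2 * 2 ^ ℓ) * 14               ≤⟨ m≤m+n _ (12 * 2 ^ q * 2 ^ ℓ) ⟩
    2 ^ q * (2 * 2 ^ ℓ) * 14 + 12 * 2 ^ q * 2 ^ ℓ
                                           ≡⟨ identity (2 ^ q) (2 ^ ℓ) ⟩
    5 * (2 ^ ℓ * (2 * (2 * (2 * 2 ^ q))))  ≡⟨ cong (5 *_) (^-distribˡ-+-* 2 ℓ (3 + q)) ⟨
    5 * 2 ^ t                              ∎
    where
    identity : ∀ x y → x * (2 * y) * 14 + 12 * x * y ≡ 5 * (y * (2 * (2 * (2 * x))))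
    identity = solve-∀

threshold-codes : ∀ q ℓ n → n < 2 ^ suc ℓ →
  let c = threshold q ℓ in suc q * n * suc c ^ c ≤ 3 ^ c * c !
threshold-codes q ℓ n n<2^[1+ℓ] = *-cancelʳ-≤ _ _ (5 ^ suc c) {{m^n≢0 5 (suc c)}} (begin
  suc q * n * suc c ^ c * 5 ^ suc c    ≡⟨ regroup (suc q * n) (suc c ^ c) (5 ^ suc c) ⟩
  suc q * n * (5 ^ suc c * suc c ^ c)  ≤⟨ *-monoʳ-≤ (suc q * n) stirling′ ⟩
  suc q * n * (14 ^ suc c * c !)       ≡⟨ regroup′ (suc q * n) (14 ^ c) (c !) ⟩
  suc q * n * 14 * 14 ^ c * c !        ≤⟨ *-monoˡ-≤ (c !) (n*14^[1+c]≤5*15^c q ℓ n n<2^[1+ℓ]) ⟩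
  5 * 15 ^ c * c !                     ≡⟨ cong (λ x → 5 * x * c !) (^-distribʳ-* 3 5 c) ⟩
  5 * (3 ^ c * 5 ^ c) * c !            ≡⟨ regroup″ (3 ^ c) (5 ^ c) (c !) ⟩
  3 ^ c * c ! * 5 ^ suc c              ∎)
  where
  c = threshold q ℓ
  stirling′ : 5 ^ suc c * suc c ^ c ≤ 14 ^ suc c * c !
  stirling′ = *-cancelˡ-≤ (suc c) (begin
    suc c * (5 ^ suc c * suc c ^ c)  ≡⟨ x∙yz≈y∙xz (suc c) (5 ^ suc c) (suc c ^ c) ⟩
    5 ^ suc c * suc c ^ suc c        ≤⟨ stirling (suc c) ⟩
    14 ^ suc c * suc c !             ≡⟨ x∙yz≈y∙xz (suc c) (14 ^ suc c) (c !) ⟨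
    suc c * (14 ^ suc c * c !)       ∎)
  regroup : ∀ x y z → x * y * z ≡ x * (z * y)
  regroup = solve-∀
  regroup′ : ∀ x y f → x * (14 * y * f) ≡ x * 14 * y * f
  regroup′ = solve-∀
  regroup″ : ∀ x y f → 5 * (x * y) * f ≡ x * f * (5 * y)
  regroup″ = solve-∀

-- ℓ₀ q is chosen so that (2c + 3) (14¹¹)^(3 + q) ≤ ℓ₀ q (1 + ℓ) ≤ 4^ℓ; together with
-- 12 · 14¹¹ ≤ 2²⁰ · 5¹¹ this gives (2c + 3) (14/5)^c ≤ 2^(20 ℓ) ≤ n^20.
ℓ₀ : ℕ → ℕ
ℓ₀ q = 22 * (14 ^ 11) ^ (3 + q) * (4 + q)

[2c+3]*14^c≤n^20*5^c : ∀ q ℓ n → 2 ^ ℓ ≤ n → ℓ₀ q ≤ ℓ →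
  let c = threshold q ℓ in (2 * c + 3) * 14 ^ c ≤ n ^ 20 * 5 ^ c
[2c+3]*14^c≤n^20*5^c q ℓ n 2^ℓ≤n ℓ₀≤ℓ = begin
  (2 * c + 3) * 14 ^ c             ≡⟨ cong ((2 * c + 3) *_) (^-*-assoc 14 11 t) ⟨
  (2 * c + 3) * a ^ t              ≡⟨ cong ((2 * c + 3) *_) (^-distribˡ-+-* a ℓ d) ⟩
  (2 * c + 3) * (a ^ ℓ * a ^ d)    ≡⟨ regroup (2 * c + 3) (a ^ ℓ) (a ^ d) ⟩
  (2 * c + 3) * a ^ d * a ^ ℓ      ≤⟨ *-monoˡ-≤ (a ^ ℓ) [2c+3]*a^d≤12^ℓ ⟩
  12 ^ ℓ * a ^ ℓ                   ≡⟨ ^-distribʳ-* 12 a ℓ ⟨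
  (12 * a) ^ ℓ                     ≤⟨ ^-monoˡ-≤ ℓ (≤ᵇ⇒≤ (12 * 14 ^ 11) (2 ^ 20 * 5 ^ 11) _) ⟩
  (2 ^ 20 * b) ^ ℓ                 ≡⟨ ^-distribʳ-* (2 ^ 20) b ℓ ⟩
  (2 ^ 20) ^ ℓ * b ^ ℓ             ≡⟨ cong (_* b ^ ℓ) (^-swap 2 20 ℓ) ⟩
  (2 ^ ℓ) ^ 20 * b ^ ℓ             ≤⟨ *-monoˡ-≤ (b ^ ℓ) (^-monoˡ-≤ 20 2^ℓ≤n) ⟩
  n ^ 20 * b ^ ℓ                   ≤⟨ *-monoʳ-≤ (n ^ 20) (m≤m*n (b ^ ℓ) (b ^ d) {{m^n≢0 b d}}) ⟩
  n ^ 20 * (b ^ ℓ * b ^ d)         ≡⟨ cong (n ^ 20 *_) (^-distribˡ-+-* b ℓ d) ⟨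
  n ^ 20 * b ^ t                   ≡⟨ cong (n ^ 20 *_) (^-*-assoc 5 11 t) ⟩
  n ^ 20 * 5 ^ c                   ∎
  where
  d = 3 + q
  t = ℓ + d
  c = 11 * t
  a = 14 ^ 11
  b = 5 ^ 11
  regroup : ∀ x y z → x * (y * z) ≡ x * z * y
  regroup = solve-∀
  ^-swap : ∀ m i j → (m ^ i) ^ j ≡ (m ^ j) ^ i
  ^-swap m i j = trans (^-*-assoc m i j) (trans (cong (m ^_) (*-comm i j)) (sym (^-*-assoc m j i)))
  [2c+3]*a^d≤12^ℓ : (2 * c + 3) * a ^ d ≤ 12 ^ ℓ
  [2c+3]*a^d≤12^ℓ = begin
    (2 * c + 3) * a ^ d             ≤⟨ *-monoˡ-≤ (a ^ d) (≤-trans (m≤m+n (2 * c + 3) (22 * d * ℓ + 19))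
                                                                  (≤-reflexive (identity ℓ d))) ⟩
    22 * (1 + d) * (1 + ℓ) * a ^ d  ≡⟨ regroup′ (1 + d) (1 + ℓ) (a ^ d) ⟩
    ℓ₀ q * (1 + ℓ)                  ≤⟨ *-mono-≤ (<⇒≤ (≤-trans (n<2^n (ℓ₀ q)) (^-monoʳ-≤ 2 ℓ₀≤ℓ)))
                                                (n<2^n ℓ) ⟩
    2 ^ ℓ * 2 ^ ℓ                   ≡⟨ ^-distribʳ-* 2 2 ℓ ⟨
    4 ^ ℓ                           ≤⟨ ^-monoˡ-≤ ℓ (≤ᵇ⇒≤ 4 12 _) ⟩
    12 ^ ℓ                          ∎
    where
    identity : ∀ ℓ d → 2 * (11 * (ℓ + d)) + 3 + (22 * d * ℓ + 19) ≡ 22 * (1 + d) * (1 + ℓ)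
    identity = solve-∀
    regroup′ : ∀ x y z → 22 * x * y * z ≡ 22 * z * x * y
    regroup′ = solve-∀

threshold-exp : ∀ q ℓ n → 2 ^ ℓ ≤ n → ℓ₀ q ≤ ℓ → ExpLe (threshold q ℓ) (n ^ 20)
threshold-exp q ℓ n 2^ℓ≤n ℓ₀≤ℓ = expLe-from c (n ^ 20) (*-cancelʳ-≤ _ _ (5 ^ c) {{m^n≢0 5 c}} (begin
  (2 * c + 3) * c ^ c * 5 ^ c    ≡⟨ regroup (2 * c + 3) (c ^ c) (5 ^ c) ⟩
  (2 * c + 3) * (5 ^ c * c ^ c)  ≤⟨ *-monoʳ-≤ (2 * c + 3) (stirling c) ⟩
  (2 * c + 3) * (14 ^ c * c !)   ≡⟨ *-assoc (2 * c + 3) (14 ^ c) (c !) ⟨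
  (2 * c + 3) * 14 ^ c * c !     ≤⟨ *-monoˡ-≤ (c !) ([2c+3]*14^c≤n^20*5^c q ℓ n 2^ℓ≤n ℓ₀≤ℓ) ⟩
  n ^ 20 * 5 ^ c * c !           ≡⟨ regroup′ (n ^ 20) (5 ^ c) (c !) ⟩
  n ^ 20 * c ! * 5 ^ c           ∎))
  where
  c = threshold q ℓ
  regroup : ∀ x y z → x * y * z ≡ x * (z * y)
  regroup = solve-∀
  regroup′ : ∀ x y z → x * y * z ≡ x * z * y
  regroup′ = solve-∀

choose : ∀ q → ∃[ N ] ∀ n → N ≤ n →
         ∃[ c ] (1 ≤ c × suc q * n * suc c ^ c ≤ 3 ^ c * c ! × ExpLe c (n ^ 20))
choose q = 2 ^ ℓ₀ q , λ n 2^ℓ₀≤n →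
  let ℓ , 2^ℓ≤n , n<2^[1+ℓ] = binary-log n (≤-trans (m^n>0 2 (ℓ₀ q)) 2^ℓ₀≤n)
      ℓ₀≤ℓ = ≮⇒≥ λ ℓ<ℓ₀ → <⇒≱ n<2^[1+ℓ] (≤-trans (^-monoʳ-≤ 2 ℓ<ℓ₀) 2^ℓ₀≤n)
  in threshold q ℓ , 1≤threshold q ℓ , threshold-codes q ℓ n n<2^[1+ℓ] , threshold-exp q ℓ n 2^ℓ≤n ℓ₀≤ℓ

length-cartesianProductWith : ∀ {A B C : Set} (f : A → B → C) xs ys →
  length (cartesianProductWith f xs ys) ≡ length xs * length ys
length-cartesianProductWith f []       ys = refl
length-cartesianProductWith f (x ∷ xs) ys = begin-equality
  length (map (f x) ys ++ cartesianProductWith f xs ys)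
    ≡⟨ length-++ (map (f x) ys) ⟩
  length (map (f x) ys) + length (cartesianProductWith f xs ys)
    ≡⟨ cong₂ _+_ (length-map (f x) ys) (length-cartesianProductWith f xs ys) ⟩
  length ys + length xs * length ys ∎

length-concatMap-≤ : ∀ {A B : Set} (f : A → List B) {b} xs →
  (∀ {x} → x ∈ xs → length (f x) ≤ b) → length (concatMap f xs) ≤ length xs * b
length-concatMap-≤ f []       _     = z≤n
length-concatMap-≤ f {b} (x ∷ xs) f≤b = begin
  length (f x ++ concatMap f xs)          ≡⟨ length-++ (f x) ⟩
  length (f x) + length (concatMap f xs)  ≤⟨ +-mono-≤ (f≤b (here refl))
                                                       (length-concatMap-≤ f xs (λ x∈ → f≤b (there x∈))) ⟩
  b + length xs * b                       ∎

[n+1]*nCk≡[k+1]*[n+1]C[k+1] : ∀ n k → suc n * (n C k) ≡ suc k * (suc n C suc k)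
[n+1]*nCk≡[k+1]*[n+1]C[k+1] zero    zero    = refl
[n+1]*nCk≡[k+1]*[n+1]C[k+1] zero    (suc k) = sym (*-zeroʳ (2 + k))
[n+1]*nCk≡[k+1]*[n+1]C[k+1] (suc n) zero    = begin-equality
  (2 + n) * 1      ≡⟨ *-identityʳ (2 + n) ⟩
  2 + n            ≡⟨ sym (nC1≡n (2 + n)) ⟩
  (2 + n) C 1        ≡⟨ sym (*-identityˡ ((2 + n) C 1)) ⟩
  1 * ((2 + n) C 1)  ∎
[n+1]*nCk≡[k+1]*[n+1]C[k+1] (suc n) (suc k) = begin-equality
  (2 + n) * (suc n C suc k)            ≡⟨ cong ((2 + n) *_) (sym (pascal n k)) ⟩
  (2 + n) * (X + Y)                    ≡⟨ expand n X Y ⟩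
  (X + Y) + (1 + n) * X + (1 + n) * Y  ≡⟨ cong₂ (λ a b → (X + Y) + a + b) ([n+1]*nCk≡[k+1]*[n+1]C[k+1] n k)
                                                                           ([n+1]*nCk≡[k+1]*[n+1]C[k+1] n (suc k)) ⟩
  (X + Y) + (1 + k) * (suc n C suc k) + (2 + k) * Z
                                       ≡⟨ cong (λ w → (X + Y) + (1 + k) * w + (2 + k) * Z) (sym (pascal n k)) ⟩
  (X + Y) + (1 + k) * (X + Y) + (2 + k) * Z ≡⟨ collect k (X + Y) Z ⟩
  (2 + k) * ((X + Y) + Z)              ≡⟨ cong (λ w → (2 + k) * (w + Z)) (pascal n k) ⟩
  (2 + k) * ((suc n C suc k) + Z)        ≡⟨ cong ((2 + k) *_) (pascal (suc n) (suc k)) ⟩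
  (2 + k) * ((2 + n) C (2 + k))          ∎
  where
  pascal = nCk+nC[k+1]≡[n+1]C[k+1]
  X = n C k
  Y = n C suc k
  Z = suc n C (2 + k)
  expand : ∀ n X Y → (2 + n) * (X + Y) ≡ (X + Y) + (1 + n) * X + (1 + n) * Y
  expand = solve-∀
  collect : ∀ k W Z → W + (1 + k) * W + (2 + k) * Z ≡ (2 + k) * (W + Z)
  collect = solve-∀

nCk≤[n+1]Ck : ∀ n k → (n C k) ≤ (suc n C k)
nCk≤[n+1]Ck n zero    = ≤-refl
nCk≤[n+1]Ck n (suc k) = ≤-trans (m≤n+m (n C suc k) (n C k)) (≤-reflexive (nCk+nC[k+1]≡[n+1]C[k+1] n k))

nCk*k!≤n^k : ∀ n k → (n C k) * k ! ≤ n ^ k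
nCk*k!≤n^k n       zero    = ≤-refl
nCk*k!≤n^k zero    (suc k) = z≤n
nCk*k!≤n^k (suc n) (suc k) = begin
  (suc n C suc k) * (suc k * k !)  ≡⟨ rearrange (suc n C suc k) (suc k) (k !) ⟩
  suc k * (suc n C suc k) * k !    ≡⟨ cong (_* k !) (sym ([n+1]*nCk≡[k+1]*[n+1]C[k+1] n k)) ⟩
  suc n * (n C k) * k !            ≡⟨ *-assoc (suc n) (n C k) (k !) ⟩
  suc n * ((n C k) * k !)          ≤⟨ *-monoʳ-≤ (suc n) (≤-trans (nCk*k!≤n^k n k) (^-monoˡ-≤ k (n≤1+n n))) ⟩
  suc n * suc n ^ k              ∎
  where
  rearrange : ∀ x y z → x * (y * z) ≡ y * x * z
  rearrange = solve-∀

combinations : (m k : ℕ) → List (Subset m)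
combinations zero    zero    = [ [] ]
combinations zero    (suc k) = []
combinations (suc m) zero    = map (outside ∷_) (combinations m zero)
combinations (suc m) (suc k) =
  map (inside ∷_) (combinations m k) ++ map (outside ∷_) (combinations m (suc k))

length-combinations : ∀ m k → length (combinations m k) ≡ (m C k)
length-combinations zero    zero    = refl
length-combinations zero    (suc k) = refl
length-combinations (suc m) zero    =
  trans (length-map (outside ∷_) (combinations m zero)) (length-combinations m zero)
length-combinations (suc m) (suc k) = begin-equality
  length (map (inside ∷_) (combinations m k) ++ map (outside ∷_) (combinations m (suc k)))
    ≡⟨ length-++ (map (inside ∷_) (combinations m k)) ⟩
  length (map (inside ∷_) (combinations m k)) + length (map (outside ∷_) (combinations m (suc k)))
    ≡⟨ cong₂ _+_ (length-map (inside ∷_) (combinations m k)) (length-map (outside ∷_) (combinations m (suc k))) ⟩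
  length (combinations m k) + length (combinations m (suc k))
    ≡⟨ cong₂ _+_ (length-combinations m k) (length-combinations m (suc k)) ⟩
  (m C k) + (m C suc k)
    ≡⟨ nCk+nC[k+1]≡[n+1]C[k+1] m k ⟩
  (suc m C suc k) ∎

∈-combinations : ∀ {m} (p : Subset m) → p ∈ combinations m ∣ p ∣
∈-combinations []             = here refl
∈-combinations (inside ∷ p)   = ∈-++⁺ˡ (∈-map⁺ (inside ∷_) (∈-combinations p))
∈-combinations {suc m} (outside ∷ p) with ∣ p ∣ | ∈-combinations p
... | zero  | p∈ = ∈-map⁺ (outside ∷_) p∈
... | suc k | p∈ = ∈-++⁺ʳ (map (inside ∷_) (combinations m k)) (∈-map⁺ (outside ∷_) p∈)

meeting : ∀ {m} → Subset m → ℕ → List (Subset m)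
meeting []            _       = []
meeting (_ ∷ A)       zero    = []
meeting {suc m} (inside ∷ A) (suc k) =
  map (inside ∷_) (combinations m k) ++ map (outside ∷_) (meeting A (suc k))
meeting (outside ∷ A) (suc k) =
  map (inside ∷_) (meeting A k) ++ map (outside ∷_) (meeting A (suc k))

meeting-zero : ∀ {m} (A : Subset m) → meeting A zero ≡ []
meeting-zero []      = refl
meeting-zero (_ ∷ A) = refl

length-meeting : ∀ {m} (A : Subset m) k → length (meeting A (suc k)) ≤ ∣ A ∣ * (pred m C k)
length-meeting []                    k = z≤n
length-meeting {suc m} (inside ∷ A) k = begin
  length (map (inside ∷_) (combinations m k) ++ map (outside ∷_) (meeting A (suc k)))
    ≡⟨ length-++ (map (inside ∷_) (combinations m k)) ⟩
  length (map (inside ∷_) (combinations m k)) + length (map (outside ∷_) (meeting A (suc k)))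
    ≡⟨ cong₂ _+_ (trans (length-map (inside ∷_) (combinations m k)) (length-combinations m k))
                 (length-map (outside ∷_) (meeting A (suc k))) ⟩
  (m C k) + length (meeting A (suc k))
    ≤⟨ +-monoʳ-≤ (m C k) (≤-trans (length-meeting A k) (*-monoʳ-≤ ∣ A ∣ (pred-C-≤ m))) ⟩
  (m C k) + ∣ A ∣ * (m C k) ∎
  where
  pred-C-≤ : ∀ m → (pred m C k) ≤ (m C k)
  pred-C-≤ zero    = ≤-refl
  pred-C-≤ (suc m) = nCk≤[n+1]Ck m k
length-meeting {suc zero} (outside ∷ []) k = z≤n
length-meeting {suc m} (outside ∷ A) zero rewrite meeting-zero A =
  ≤-trans (≤-reflexive (length-map (outside ∷_) (meeting A 1))) (length-meeting A zero)
length-meeting {suc (suc m)} (outside ∷ A) (suc k) = begin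
  length (map (inside ∷_) (meeting A (suc k)) ++ map (outside ∷_) (meeting A (2 + k)))
    ≡⟨ length-++ (map (inside ∷_) (meeting A (suc k))) ⟩
  length (map (inside ∷_) (meeting A (suc k))) + length (map (outside ∷_) (meeting A (2 + k)))
    ≡⟨ cong₂ _+_ (length-map (inside ∷_) (meeting A (suc k))) (length-map (outside ∷_) (meeting A (2 + k))) ⟩
  length (meeting A (suc k)) + length (meeting A (2 + k))
    ≤⟨ +-mono-≤ (length-meeting A k) (length-meeting A (suc k)) ⟩
  ∣ A ∣ * (m C k) + ∣ A ∣ * (m C suc k)
    ≡⟨ sym (*-distribˡ-+ ∣ A ∣ (m C k) (m C suc k)) ⟩
  ∣ A ∣ * ((m C k) + (m C suc k))
    ≡⟨ cong (∣ A ∣ *_) (nCk+nC[k+1]≡[n+1]C[k+1] m k) ⟩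
  ∣ A ∣ * (suc m C suc k) ∎

∈-meeting : ∀ {m} (A X : Subset m) → Nonempty (A ∩ X) → X ∈ meeting A ∣ X ∣
∈-meeting {suc m} (inside ∷ A) (inside ∷ X) _ =
  ∈-++⁺ˡ (∈-map⁺ (inside ∷_) (∈-combinations X))
∈-meeting (outside ∷ A) (inside ∷ X) (suc i , there i∈A∩X) =
  ∈-++⁺ˡ (∈-map⁺ (inside ∷_) (∈-meeting A X (i , i∈A∩X)))
∈-meeting (a ∷ A) (outside ∷ X) (suc i , there i∈A∩X) =
  ∈-meeting-outside a A X (∈-meeting A X (i , i∈A∩X))
  where
  ∈-meeting-outside : ∀ {m} a (A X : Subset m) → X ∈ meeting A ∣ X ∣ →
                      outside ∷ X ∈ meeting (a ∷ A) ∣ X ∣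
  ∈-meeting-outside a A X X∈ with ∣ X ∣ | X∈
  ... | zero  | X∈′ rewrite meeting-zero A = contradiction X∈′ ¬Any[]
  ∈-meeting-outside inside  A X X∈ | suc k | X∈′ = ∈-++⁺ʳ _ (∈-map⁺ (outside ∷_) X∈′)
  ∈-meeting-outside outside A X X∈ | suc k | X∈′ = ∈-++⁺ʳ _ (∈-map⁺ (outside ∷_) X∈′)

-- Cut off for ∣ A ∣ > k, so that its length is at most k C(m - 1, k - 1) for every A.
meeting≤ : ∀ {m} → Subset m → ℕ → List (Subset m)
meeting≤ A k with ∣ A ∣ ≤? k
... | yes _ = meeting A k
... | no  _ = []

meetBound : ℕ → ℕ → ℕ
meetBound m k = k * (pred m C pred k)

length-meeting≤ : ∀ {m} (A : Subset m) k → length (meeting≤ A k) ≤ meetBound m k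
length-meeting≤ A k with ∣ A ∣ ≤? k
length-meeting≤ A zero    | yes _ rewrite meeting-zero A = z≤n
length-meeting≤ {m} A (suc k) | yes ∣A∣≤k =
  ≤-trans (length-meeting A k) (*-monoˡ-≤ (pred m C k) ∣A∣≤k)
... | no _ = z≤n

∈-meeting≤ : ∀ {m} {A X : Subset m} {k} → ∣ A ∣ ≤ k → ∣ X ∣ ≡ k → Nonempty (A ∩ X) →
             X ∈ meeting≤ A k
∈-meeting≤ {A = A} {X} {k} ∣A∣≤k refl A∩X≢∅ with ∣ A ∣ ≤? k
... | yes _    = ∈-meeting A X A∩X≢∅
... | no ∣A∣≰k = contradiction ∣A∣≤k ∣A∣≰k

m*meetBound≡k*k*mCk : ∀ m k → m * meetBound m k ≡ k * k * (m C k)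
m*meetBound≡k*k*mCk zero    zero    = refl
m*meetBound≡k*k*mCk zero    (suc k) = sym (*-zeroʳ (suc k * suc k))
m*meetBound≡k*k*mCk (suc m) zero    = *-zeroʳ (suc m)
m*meetBound≡k*k*mCk (suc m) (suc k) = begin-equality
  suc m * (suc k * (m C k))   ≡⟨ x∙yz≈y∙xz (suc m) (suc k) (m C k) ⟩
  suc k * (suc m * (m C k))   ≡⟨ cong (suc k *_) ([n+1]*nCk≡[k+1]*[n+1]C[k+1] m k) ⟩
  suc k * (suc k * (suc m C suc k)) ≡⟨ *-assoc (suc k) (suc k) _ ⟨
  suc k * suc k * (suc m C suc k) ∎

-- Trees and the list-assignments along them

∣p[x]≔inside∣≡1+∣p∣ : ∀ {n} {p : Subset n} {x} → x ∉ₛ p → ∣ p [ x ]≔ inside ∣ ≡ suc ∣ p ∣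
∣p[x]≔inside∣≡1+∣p∣ {p = outside ∷ p} {zero}  x∉p = refl
∣p[x]≔inside∣≡1+∣p∣ {p = inside  ∷ p} {zero}  x∉p = contradiction here x∉p
∣p[x]≔inside∣≡1+∣p∣ {p = outside ∷ p} {suc x} x∉p = ∣p[x]≔inside∣≡1+∣p∣ (x∉p ∘ there)
∣p[x]≔inside∣≡1+∣p∣ {p = inside  ∷ p} {suc x} x∉p = cong suc (∣p[x]≔inside∣≡1+∣p∣ (x∉p ∘ there))

∈-update⁺ : ∀ {n} {p : Subset n} {x} y → x ∈ₛ p → x ∈ₛ p [ y ]≔ inside
∈-update⁺ {p = p} {x} y x∈p with x ≟ᶠ y
... | yes refl = []≔-updates p x
... | no  x≢y  = []≔-minimal p x y x≢y x∈p

∈-update⁻ : ∀ {n} {p : Subset n} {x} y → x ∈ₛ p [ y ]≔ inside → x ≡ y ⊎ x ∈ₛ p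
∈-update⁻ {p = p} {x} y x∈p′ with x ≟ᶠ y
... | yes x≡y = inj₁ x≡y
... | no  x≢y = inj₂ (lookup⇒[]= x p (trans (sym (lookup∘update′ x≢y p inside)) ([]=⇒lookup x∈p′)))

tabulate-≗ : ∀ {A : Set} {n} {f : Fin n → A} {xs} → (∀ i → f i ≡ lookup xs i) → tabulate f ≡ xs
tabulate-≗ {xs = xs} f≗xs = trans (tabulate-cong f≗xs) (tabulate∘lookup xs)

-- An edge (x , y) attaches the new vertex y to x; lists of edges are newest first.
Edges : ℕ → Set
Edges n = List (Fin n × Fin n)

vertices : ∀ {n} → Fin n → Edges n → Subset n
vertices v []            = ⊥ [ v ]≔ inside
vertices v ((_ , y) ∷ E) = vertices v E [ y ]≔ inside

module _ {n : ℕ} {v : Fin n} where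

  root∈vertices : ∀ E → v ∈ₛ vertices v E
  root∈vertices []            = []≔-updates ⊥ v
  root∈vertices ((_ , y) ∷ E) = ∈-update⁺ y (root∈vertices E)

  vertices-++⁺ : ∀ N {E z} → z ∈ₛ vertices v E → z ∈ₛ vertices v (N ++ E)
  vertices-++⁺ []            z∈ = z∈
  vertices-++⁺ ((_ , y) ∷ N) z∈ = ∈-update⁺ y (vertices-++⁺ N z∈)

  vertices-++⁻ : ∀ N {E z} → z ∈ₛ vertices v (N ++ E) → z ∈ map proj₂ N ⊎ z ∈ₛ vertices v E
  vertices-++⁻ []            z∈ = inj₂ z∈
  vertices-++⁻ ((_ , y) ∷ N) z∈ with ∈-update⁻ y z∈
  ... | inj₁ refl = inj₁ (here refl)
  ... | inj₂ z∈′  = Sum.map₁ there (vertices-++⁻ N z∈′)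

  ∈-vertices-++ : ∀ N {E z} → z ∈ map proj₂ N → z ∈ₛ vertices v (N ++ E)
  ∈-vertices-++ ((_ , y) ∷ N) (here refl) = []≔-updates (vertices v (N ++ _)) y
  ∈-vertices-++ ((_ , y) ∷ N) (there z∈)  = ∈-update⁺ y (∈-vertices-++ N z∈)

module _ {n m : ℕ} (L : ListAssignment n m) (v : Fin n) where

  -- Adjacency in G is not recorded: the count only needs the lists to meet along the edges.
  data MeetingTree : Edges n → Set where
    root : MeetingTree []
    grow : ∀ {E x y} → x ∈ₛ vertices v E → y ∉ₛ vertices v E →
           Nonempty (lookup L x ∩ lookup L y) → MeetingTree E → MeetingTree ((x , y) ∷ E)

  ∣vertices∣ : ∀ {E} → MeetingTree E → ∣ vertices v E ∣ ≡ suc (length E)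
  ∣vertices∣ root               = trans (∣p[x]≔inside∣≡1+∣p∣ {p = ⊥} {v} ∉⊥) (cong suc (∣⊥∣≡0 n))
  ∣vertices∣ (grow _ y∉ _ tree) = trans (∣p[x]≔inside∣≡1+∣p∣ y∉) (cong suc (∣vertices∣ tree))

module _ {m : ℕ} (k : ℕ) where

  assignmentsOff : ∀ {n} → Subset n → List (ListAssignment n m)
  assignmentsOff []            = [ [] ]
  assignmentsOff (inside  ∷ S) = map (⊥ ∷_) (assignmentsOff S)
  assignmentsOff (outside ∷ S) = cartesianProductWith _∷_ (combinations m k) (assignmentsOff S)

  length-assignmentsOff : ∀ {n} (S : Subset n) → length (assignmentsOff S) ≡ (m C k) ^ ∣ ∁ S ∣
  length-assignmentsOff []            = refl
  length-assignmentsOff (inside  ∷ S) =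
    trans (length-map (⊥ ∷_) (assignmentsOff S)) (length-assignmentsOff S)
  length-assignmentsOff (outside ∷ S) = begin-equality
    length (cartesianProductWith _∷_ (combinations m k) (assignmentsOff S))
      ≡⟨ length-cartesianProductWith _∷_ (combinations m k) (assignmentsOff S) ⟩
    length (combinations m k) * length (assignmentsOff S)
      ≡⟨ cong₂ _*_ (length-combinations m k) (length-assignmentsOff S) ⟩
    (m C k) * (m C k) ^ ∣ ∁ S ∣ ∎

  alongTree : ∀ {n} → Fin n → Subset n → Edges n → List (ListAssignment n m)
  alongTree v S []            =
    cartesianProductWith (λ V X → V [ v ]≔ X) (assignmentsOff S) (combinations m k)
  alongTree v S ((x , y) ∷ E) =
    concatMap (λ V → map (V [ y ]≔_) (meeting≤ (lookup V x) k)) (alongTree v S E)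

  length-alongTree : ∀ {n} v (S : Subset n) E →
    length (alongTree v S E) ≤ (m C k) ^ ∣ ∁ S ∣ * (m C k) * meetBound m k ^ length E
  length-alongTree v S [] = ≤-reflexive (begin-equality
    length (cartesianProductWith (λ V X → V [ v ]≔ X) (assignmentsOff S) (combinations m k))
      ≡⟨ length-cartesianProductWith _ (assignmentsOff S) (combinations m k) ⟩
    length (assignmentsOff S) * length (combinations m k)
      ≡⟨ cong₂ _*_ (length-assignmentsOff S) (length-combinations m k) ⟩
    (m C k) ^ ∣ ∁ S ∣ * (m C k)
      ≡⟨ *-identityʳ _ ⟨
    (m C k) ^ ∣ ∁ S ∣ * (m C k) * 1 ∎)
  length-alongTree v S ((x , y) ∷ E) = begin
    length (concatMap (λ V → map (V [ y ]≔_) (meeting≤ (lookup V x) k)) (alongTree v S E))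
      ≤⟨ length-concatMap-≤ (λ V → map (V [ y ]≔_) (meeting≤ (lookup V x) k)) (alongTree v S E)
           (λ {V} _ → ≤-trans (≤-reflexive (length-map (V [ y ]≔_) (meeting≤ (lookup V x) k)))
                              (length-meeting≤ (lookup V x) k)) ⟩
    length (alongTree v S E) * meetBound m k
      ≤⟨ *-monoˡ-≤ (meetBound m k) (length-alongTree v S E) ⟩
    (m C k) ^ ∣ ∁ S ∣ * (m C k) * meetBound m k ^ length E * meetBound m k
      ≡⟨ *-assoc ((m C k) ^ ∣ ∁ S ∣ * (m C k)) (meetBound m k ^ length E) (meetBound m k) ⟩
    (m C k) ^ ∣ ∁ S ∣ * (m C k) * (meetBound m k ^ length E * meetBound m k)
      ≡⟨ cong ((m C k) ^ ∣ ∁ S ∣ * (m C k) *_) (*-comm (meetBound m k ^ length E) (meetBound m k)) ⟩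
    (m C k) ^ ∣ ∁ S ∣ * (m C k) * meetBound m k ^ suc (length E) ∎

  -- The tree vertices S receive their lists one edge at a time; hide S D L is L at the stage
  -- where only those in D have been revealed.
  hideAt : ∀ {n} → Subset n → Subset n → ListAssignment n m → Fin n → Subset m
  hideAt S D L i = if lookup S i ∧ not (lookup D i) then ⊥ else lookup L i

  hide : ∀ {n} → Subset n → Subset n → ListAssignment n m → ListAssignment n m
  hide S D L = tabulate (hideAt S D L)

  kList∈combinations : ∀ {n} (L : ListAssignment n m) → IsKList k L → ∀ v → lookup L v ∈ combinations m k
  kList∈combinations L kl v =
    subst (λ j → lookup L v ∈ combinations m j) (kl v) (∈-combinations (lookup L v))

  hide-⊥ : ∀ {n} (S : Subset n) (L : ListAssignment n m) → IsKList k L →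
           hide S ⊥ L ∈ assignmentsOff S
  hide-⊥ []            []      _  = here refl
  hide-⊥ (inside  ∷ S) (X ∷ L) kl = ∈-map⁺ (⊥ ∷_) (hide-⊥ S L (kl ∘ suc))
  hide-⊥ (outside ∷ S) (X ∷ L) kl =
    ∈-cartesianProductWith⁺ _∷_ (kList∈combinations (X ∷ L) kl zero) (hide-⊥ S L (kl ∘ suc))

  hide-update : ∀ {n} (S D : Subset n) L y → hide S (D [ y ]≔ inside) L ≡ hide S D L [ y ]≔ lookup L y
  hide-update S D L y = tabulate-≗ pointwise
    where
    pointwise : ∀ i → hideAt S (D [ y ]≔ inside) L i ≡ lookup (hide S D L [ y ]≔ lookup L y) i
    pointwise i with i ≟ᶠ y
    ... | yes refl rewrite lookup∘update i D inside | ∧-zeroʳ (lookup S i)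
                         | lookup∘update i (hide S D L) (lookup L i) = refl
    ... | no i≢y   rewrite lookup∘update′ i≢y D inside | lookup∘update′ i≢y (hide S D L) (lookup L y)
                         = sym (lookup∘tabulate (hideAt S D L) i)

  hide-visible : ∀ {n} (S D : Subset n) L {x} → lookup D x ≡ inside → lookup (hide S D L) x ≡ lookup L x
  hide-visible S D L {x} x∈D rewrite lookup∘tabulate (hideAt S D L) x | x∈D | ∧-zeroʳ (lookup S x) = refl

  hide-all : ∀ {n} (S : Subset n) L → hide S S L ≡ L
  hide-all S L = tabulate-≗ pointwise
    where
    pointwise : ∀ i → hideAt S S L i ≡ lookup L i
    pointwise i with lookup S i
    ... | inside  = refl
    ... | outside = refl

  ∈-alongTree : ∀ {n} {L : ListAssignment n m} {v} (S : Subset n) {E} → IsKList k L →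
                MeetingTree L v E → hide S (vertices v E) L ∈ alongTree v S E
  ∈-alongTree {L = L} {v} S kl root =
    subst (_∈ alongTree v S []) (sym (hide-update S ⊥ L v))
      (∈-cartesianProductWith⁺ (λ V X → V [ v ]≔ X) (hide-⊥ S L kl) (kList∈combinations L kl v))
  ∈-alongTree {L = L} {v} S kl (grow {E} {x} {y} x∈ _ meets tree) =
    subst (_∈ alongTree v S ((x , y) ∷ E)) (sym (hide-update S (vertices v E) L y))
      (∈-concatMap⁺ (λ V → map (V [ y ]≔_) (meeting≤ (lookup V x) k))
        (lose (∈-alongTree S kl tree) (∈-map⁺ (hide S (vertices v E) L [ y ]≔_) Ly∈)))
    where
    Ly∈ : lookup L y ∈ meeting≤ (lookup (hide S (vertices v E) L) x) k
    Ly∈ rewrite hide-visible S (vertices v E) L ([]=⇒lookup x∈) =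
      ∈-meeting≤ (≤-reflexive (kl x)) (kl y) meets

-- Exploration of B(G, L)

length-filter-tabulate : ∀ {A : Set} {n} (f : A → Bool) (g : Fin n → A) →
  length (filter (T? ∘ f) (List.tabulate g)) ≡ ∣ tabulate (f ∘ g) ∣
length-filter-tabulate {n = zero}  f g = refl
length-filter-tabulate {n = suc n} f g with f (g zero)
... | true  = cong suc (length-filter-tabulate f (g ∘ suc))
... | false = length-filter-tabulate f (g ∘ suc)

≤-foldr-⊔ : ∀ {A : Set} (f : A → ℕ) {x xs} → x ∈ xs → f x ≤ foldr _⊔_ 0 (map f xs)
≤-foldr-⊔ f {xs = y ∷ xs} (here refl) = m≤m⊔n (f y) _
≤-foldr-⊔ f {xs = y ∷ xs} (there x∈)  = ≤-trans (≤-foldr-⊔ f x∈) (m≤n⊔m (f y) _)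

trues : List Bool → ℕ
trues bs = ∣ fromList bs ∣

trues-++ : ∀ bs bs′ → trues (bs ++ bs′) ≡ trues bs + trues bs′
trues-++ []           bs′ = refl
trues-++ (true  ∷ bs) bs′ = cong suc (trues-++ bs bs′)
trues-++ (false ∷ bs) bs′ = trues-++ bs bs′

trues-replicate-false : ∀ k → trues (replicate k false) ≡ 0
trues-replicate-false zero    = refl
trues-replicate-false (suc k) = trues-replicate-false k

module Exploration {n} (G : Graph n) where

  Δ : ℕ
  Δ = maxDegree G

  neighbours : Fin n → List (Fin n)
  neighbours x = filter (T? ∘ adj G x) (allFin n)

  length-neighbours : ∀ x → length (neighbours x) ≤ Δ
  length-neighbours x = ≤-trans (≤-reflexive (length-filter-tabulate (adj G x) (λ i → i)))
                                (≤-foldr-⊔ (degree G) (∈-allFin x))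

  ∈-neighbours : ∀ {x y} → adj G x y ≡ true → y ∈ neighbours x
  ∈-neighbours {x} {y} xy∈G = ∈-filter⁺ (T? ∘ adj G x) (∈-allFin y) (subst T (sym xy∈G) _)

  -- The queue of vertices still to be scanned, and the tree found so far.
  State : Set
  State = List (Fin n) × Edges n

  decodeScan : Fin n → List (Fin n) → List Bool → State → List Bool × State
  decodeScan x []       bs           σ       = bs , σ
  decodeScan x (y ∷ ys) []           σ       = [] , σ
  decodeScan x (y ∷ ys) (true  ∷ bs) (Q , E) = decodeScan x ys bs (y ∷ Q , (x , y) ∷ E)
  decodeScan x (y ∷ ys) (false ∷ bs) σ       = decodeScan x ys bs σ

  decode : ℕ → List Bool → State → State
  decode zero    bs σ           = σ
  decode (suc r) bs ([] , E)    = [] , E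
  decode (suc r) bs (x ∷ Q , E) = uncurry (decode r) (decodeScan x (neighbours x) bs (Q , E))

  module Encoding {m} (L : ListAssignment n m) (c : ℕ) (v : Fin n) where

    Accept : Fin n → Fin n → Edges n → Set
    Accept x y E = Nonempty (lookup L x ∩ lookup L y) × y ∉ₛ vertices v E × length E < c

    accept? : ∀ x y E → Dec (Accept x y E)
    accept? x y E = nonempty? _ ×-dec ¬? (y ∈ₛ? vertices v E) ×-dec length E <? c

    scan : Fin n → List (Fin n) → State → List Bool × State
    scan x []       σ       = [] , σ
    scan x (y ∷ ys) (Q , E) with accept? x y E
    ... | yes _ = map₁ (true ∷_) (scan x ys (y ∷ Q , (x , y) ∷ E))
    ... | no  _ = map₁ (false ∷_) (scan x ys (Q , E))

    explore : ℕ → State → List Bool × State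
    explore zero    σ           = [] , σ
    explore (suc r) ([] , E)    = [] , ([] , E)
    explore (suc r) (x ∷ Q , E) =
      let bs , σ′ = scan x (neighbours x) (Q , E) in map₁ (bs ++_) (explore r σ′)

    decodeScan-scan : ∀ x ys σ rest →
      decodeScan x ys (proj₁ (scan x ys σ) ++ rest) σ ≡ (rest , proj₂ (scan x ys σ))
    decodeScan-scan x []       σ       rest = refl
    decodeScan-scan x (y ∷ ys) (Q , E) rest with accept? x y E
    ... | yes _ = decodeScan-scan x ys (y ∷ Q , (x , y) ∷ E) rest
    ... | no  _ = decodeScan-scan x ys (Q , E) rest

    decode-explore : ∀ r σ rest → decode r (proj₁ (explore r σ) ++ rest) σ ≡ proj₂ (explore r σ)
    decode-explore zero    σ           rest = refl
    decode-explore (suc r) ([] , E)    rest = refl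
    decode-explore (suc r) (x ∷ Q , E) rest
      rewrite ++-assoc (proj₁ (scan x (neighbours x) (Q , E)))
                       (proj₁ (explore r (proj₂ (scan x (neighbours x) (Q , E))))) rest
            | decodeScan-scan x (neighbours x) (Q , E)
                (proj₁ (explore r (proj₂ (scan x (neighbours x) (Q , E)))) ++ rest)
      = decode-explore r (proj₂ (scan x (neighbours x) (Q , E))) rest

    scan-shape : ∀ x ys Q E → ∃ λ N →
      trues (proj₁ (scan x ys (Q , E))) ≡ length N ×
      proj₂ (scan x ys (Q , E)) ≡ (map proj₂ N ++ Q , N ++ E)
    scan-shape x []       Q E = [] , refl , refl
    scan-shape x (y ∷ ys) Q E with accept? x y E
    ... | no  _ = scan-shape x ys Q E
    ... | yes _ with scan-shape x ys (y ∷ Q) ((x , y) ∷ E)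
    ...   | N , trues≡ , σ≡ = N ++ [ x , y ] , trans (cong suc trues≡) (sym length-snoc) ,
                              trans σ≡ (cong₂ _,_ queue-snoc (sym (++-assoc N [ x , y ] E)))
      where
      length-snoc : length (N ++ [ x , y ]) ≡ suc (length N)
      length-snoc = trans (length-++ N) (+-comm (length N) 1)
      queue-snoc : map proj₂ N ++ y ∷ Q ≡ map proj₂ (N ++ [ x , y ]) ++ Q
      queue-snoc = sym (trans (cong (_++ Q) (map-++ proj₂ N [ x , y ])) (++-assoc (map proj₂ N) [ y ] Q))

    length-scan : ∀ x ys σ → length (proj₁ (scan x ys σ)) ≡ length ys
    length-scan x []       σ       = refl
    length-scan x (y ∷ ys) (Q , E) with accept? x y E
    ... | yes _ = cong suc (length-scan x ys (y ∷ Q , (x , y) ∷ E))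
    ... | no  _ = cong suc (length-scan x ys (Q , E))

    Settled : Edges n → Fin n → Set
    Settled E y = y ∈ₛ vertices v E ⊎ c ≤ length E

    settled-++ : ∀ N {E y} → Settled E y → Settled (N ++ E) y
    settled-++ N     (inj₁ y∈) = inj₁ (vertices-++⁺ N y∈)
    settled-++ N {E} (inj₂ c≤) = inj₂ (≤-trans c≤ (≤-trans (m≤n+m (length E) (length N))
                                                            (≤-reflexive (sym (length-++ N)))))

    ClosedAt : Edges n → Fin n → Set
    ClosedAt E x = ∀ {y} → Dangerous G L x y → Settled E y

    scan-monotone : ∀ x ys Q E {y} → Settled E y → Settled (proj₂ (proj₂ (scan x ys (Q , E)))) y
    scan-monotone x ys Q E settled with scan-shape x ys Q E
    ... | N , _ , σ≡ rewrite σ≡ = settled-++ N settled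

    scan-settles : ∀ x ys Q E {y} → y ∈ ys → Nonempty (lookup L x ∩ lookup L y) →
                   Settled (proj₂ (proj₂ (scan x ys (Q , E)))) y
    scan-settles x (y ∷ ys) Q E (here refl) meets with accept? x y E
    ... | yes _ = scan-monotone x ys (y ∷ Q) ((x , y) ∷ E) (inj₁ ([]≔-updates (vertices v E) y))
    ... | no ¬accept with y ∈ₛ? vertices v E | length E <? c
    ...   | yes y∈ | _        = scan-monotone x ys Q E (inj₁ y∈)
    ...   | no  y∉ | yes room = contradiction (meets , y∉ , room) ¬accept
    ...   | no  y∉ | no  full = scan-monotone x ys Q E (inj₂ (≮⇒≥ full))
    scan-settles x (z ∷ ys) Q E (there y∈) meets with accept? x z E
    ... | yes _ = scan-settles x ys (z ∷ Q) ((x , z) ∷ E) y∈ meets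
    ... | no  _ = scan-settles x ys Q E y∈ meets

    scan-tree : ∀ x ys Q E → x ∈ₛ vertices v E → MeetingTree L v E → length E ≤ c →
                let E′ = proj₂ (proj₂ (scan x ys (Q , E))) in MeetingTree L v E′ × length E′ ≤ c
    scan-tree x []       Q E x∈ tree budget = tree , budget
    scan-tree x (y ∷ ys) Q E x∈ tree budget with accept? x y E
    ... | yes (meets , y∉ , room) =
      scan-tree x ys (y ∷ Q) ((x , y) ∷ E) (∈-update⁺ y x∈) (grow x∈ y∉ meets tree) room
    ... | no  _ = scan-tree x ys Q E x∈ tree budget

    record Invariant (r : ℕ) (Q : List (Fin n)) (E : Edges n) : Set where
      field
        tree     : MeetingTree L v E
        budget   : length E ≤ c
        queued   : ∀ {x} → x ∈ Q → x ∈ₛ vertices v E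
        frontier : ∀ {x} → x ∈ₛ vertices v E → x ∈ Q ⊎ ClosedAt E x
        -- r rounds remain; this forces the queue to be empty after the last round.
        fuel     : Q ≡ [] ⊎ length Q + c ≤ r + length E

    dangerous⇒meets : ∀ {x y} → Dangerous G L x y → Nonempty (lookup L x ∩ lookup L y)
    dangerous⇒meets (_ , i , i∈Lx , i∈Ly) = i , x∈p∩q⁺ (i∈Lx , i∈Ly)

    round-invariant : ∀ {r x Q E} → Invariant (suc r) (x ∷ Q) E →
                      uncurry (Invariant r) (proj₂ (scan x (neighbours x) (Q , E)))
    round-invariant {r} {x} {Q} {E} inv
      with proj₂ (scan x (neighbours x) (Q , E))
         | scan-shape x (neighbours x) Q E
         | scan-tree x (neighbours x) Q E (Invariant.queued inv (here refl))
                     (Invariant.tree inv) (Invariant.budget inv)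
         | (λ {y} → scan-settles x (neighbours x) Q E {y})
    ... | ._ | N , _ , refl | tree′ , budget′ | settles = record
      { tree     = tree′
      ; budget   = budget′
      ; queued   = queued′
      ; frontier = frontier′
      ; fuel     = inj₂ fuel′
      }
      where
      open Invariant inv
      queued′ : ∀ {z} → z ∈ map proj₂ N ++ Q → z ∈ₛ vertices v (N ++ E)
      queued′ z∈ with ∈-++⁻ (map proj₂ N) z∈
      ... | inj₁ z∈N = ∈-vertices-++ N z∈N
      ... | inj₂ z∈Q = vertices-++⁺ N (queued (there z∈Q))
      frontier′ : ∀ {z} → z ∈ₛ vertices v (N ++ E) → z ∈ map proj₂ N ++ Q ⊎ ClosedAt (N ++ E) z
      frontier′ z∈ with vertices-++⁻ N z∈
      ... | inj₁ z∈N = inj₁ (∈-++⁺ˡ z∈N)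
      ... | inj₂ z∈E with frontier z∈E
      ...   | inj₁ (here refl) = inj₂ λ xy∈B → settles (∈-neighbours (proj₁ xy∈B)) (dangerous⇒meets xy∈B)
      ...   | inj₁ (there z∈Q) = inj₁ (∈-++⁺ʳ (map proj₂ N) z∈Q)
      ...   | inj₂ closed      = inj₂ λ zy∈B → settled-++ N (closed zy∈B)
      fuel′ : length (map proj₂ N ++ Q) + c ≤ r + length (N ++ E)
      fuel′ with fuel
      ... | inj₂ (s≤s fuel) = begin
        length (map proj₂ N ++ Q) + c    ≡⟨ cong (_+ c) (length-++ (map proj₂ N)) ⟩
        length (map proj₂ N) + length Q + c
                                         ≡⟨ cong (λ l → l + length Q + c) (length-map proj₂ N) ⟩
        length N + length Q + c          ≡⟨ +-assoc (length N) (length Q) c ⟩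
        length N + (length Q + c)        ≤⟨ +-monoʳ-≤ (length N) fuel ⟩
        length N + (r + length E)        ≡⟨ +-x∙yz≈y∙xz (length N) r (length E) ⟩
        r + (length N + length E)        ≡⟨ cong (r +_) (length-++ N) ⟨
        r + length (N ++ E)              ∎
        where open CommSemigroupProperties +-commutativeSemigroup renaming (x∙yz≈y∙xz to +-x∙yz≈y∙xz)

    explore-invariant : ∀ r {Q E} → Invariant r Q E → uncurry (Invariant 0) (proj₂ (explore r (Q , E)))
    explore-invariant zero            inv = inv
    explore-invariant (suc r) {[]}    inv = record { Invariant inv ; fuel = inj₁ refl }
    explore-invariant (suc r) {x ∷ Q} inv = explore-invariant r (round-invariant inv)

    finished-queue-empty : ∀ {Q E} → Invariant 0 Q E → Q ≡ []
    finished-queue-empty {[]}        _   = refl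
    finished-queue-empty {x ∷ Q} {E} inv with Invariant.fuel inv
    ... | inj₂ overfull = contradiction (≤-trans (s≤s (m≤n+m c (length Q)))
                                          (≤-trans overfull (Invariant.budget inv))) (<-irrefl refl)

    finished-closed : ∀ {Q E} → Invariant 0 Q E → ∀ {x} → x ∈ₛ vertices v E → ClosedAt E x
    finished-closed inv x∈ with Invariant.frontier inv x∈ | finished-queue-empty inv
    ... | inj₂ closed | _    = closed
    ... | inj₁ ()     | refl

    invariant₀ : Invariant (suc c) [ v ] []
    invariant₀ = record
      { tree     = root
      ; budget   = z≤n
      ; queued   = λ { (here refl) → []≔-updates ⊥ v }
      ; frontier = λ x∈ → inj₁ (here (root-only x∈))
      ; fuel     = inj₂ (≤-reflexive (sym (+-identityʳ (suc c))))
      }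
      where
      root-only : ∀ {x} → x ∈ₛ ⊥ [ v ]≔ inside → x ≡ v
      root-only x∈ with ∈-update⁻ v x∈
      ... | inj₁ x≡v = x≡v
      ... | inj₂ x∈⊥ = contradiction x∈⊥ ∉⊥

    length-explore : ∀ r σ → length (proj₁ (explore r σ)) ≤ r * Δ
    length-explore zero    σ           = z≤n
    length-explore (suc r) ([] , E)    = z≤n
    length-explore (suc r) (x ∷ Q , E) = begin
      length (bs ++ bs′)                  ≡⟨ length-++ bs ⟩
      length bs + length bs′              ≡⟨ cong (_+ length bs′) (length-scan x (neighbours x) (Q , E)) ⟩
      length (neighbours x) + length bs′  ≤⟨ +-mono-≤ (length-neighbours x) (length-explore r σ′) ⟩
      Δ + r * Δ                           ∎
      where
      bs = proj₁ (scan x (neighbours x) (Q , E))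
      σ′ = proj₂ (scan x (neighbours x) (Q , E))
      bs′ = proj₁ (explore r σ′)

    trues-explore : ∀ r Q E →
      trues (proj₁ (explore r (Q , E))) + length E ≡ length (proj₂ (proj₂ (explore r (Q , E))))
    trues-explore zero    Q       E = refl
    trues-explore (suc r) []      E = refl
    trues-explore (suc r) (x ∷ Q) E
      with proj₁ (scan x (neighbours x) (Q , E)) | proj₂ (scan x (neighbours x) (Q , E))
         | scan-shape x (neighbours x) Q E
    ... | bs | ._ | N , trues≡ , refl = begin-equality
      trues (bs ++ bs′) + length E               ≡⟨ cong (_+ length E) (trues-++ bs bs′) ⟩
      trues bs + trues bs′ + length E            ≡⟨ cong (λ t → t + trues bs′ + length E) trues≡ ⟩
      length N + trues bs′ + length E            ≡⟨ cong (_+ length E) (+-comm (length N) (trues bs′)) ⟩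
      trues bs′ + length N + length E            ≡⟨ +-assoc (trues bs′) (length N) (length E) ⟩
      trues bs′ + (length N + length E)          ≡⟨ cong (trues bs′ +_) (length-++ N) ⟨
      trues bs′ + length (N ++ E)                ≡⟨ trues-explore r (map proj₂ N ++ Q) (N ++ E) ⟩
      length (proj₂ (proj₂ (explore r (map proj₂ N ++ Q , N ++ E)))) ∎
      where bs′ = proj₁ (explore r (map proj₂ N ++ Q , N ++ E))

-- The bad list-assignments

-- Every one of the c tree edges costs a factor k²/m.
edges-cost : ∀ m k f c → m ^ c * ((m C k) ^ f * (m C k) * meetBound m k ^ c) ≡ (m C k) ^ (f + suc c) * (k * k) ^ c
edges-cost m k f c = begin-equality
  m ^ c * (N ^ f * N * K ^ c)          ≡⟨ regroup (m ^ c) (N ^ f) N (K ^ c) ⟩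
  N ^ f * N * (m ^ c * K ^ c)          ≡⟨ cong (N ^ f * N *_) (sym (^-distribʳ-* m K c)) ⟩
  N ^ f * N * (m * K) ^ c              ≡⟨ cong (λ x → N ^ f * N * x ^ c) (m*meetBound≡k*k*mCk m k) ⟩
  N ^ f * N * (k * k * N) ^ c          ≡⟨ cong (N ^ f * N *_) (^-distribʳ-* (k * k) N c) ⟩
  N ^ f * N * ((k * k) ^ c * N ^ c)    ≡⟨ regroup′ (N ^ f) N ((k * k) ^ c) (N ^ c) ⟩
  N ^ f * (N * N ^ c) * (k * k) ^ c    ≡⟨ cong (_* (k * k) ^ c) (sym (^-distribˡ-+-* N f (suc c))) ⟩
  N ^ (f + suc c) * (k * k) ^ c        ∎
  where
  N = m C k
  K = meetBound m k
  regroup : ∀ a b c d → a * (b * c * d) ≡ b * c * (a * d)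
  regroup = solve-∀
  regroup′ : ∀ a b c d → a * b * (c * d) ≡ a * (b * d) * c
  regroup′ = solve-∀

codes-cost : ∀ q n c Δ k m → suc q * n * suc c ^ c ≤ 3 ^ c * c ! → 3 * (k * k) * Δ ≤ m →
             suc q * n * (suc c * Δ) ^ c * (k * k) ^ c ≤ c ! * m ^ c
codes-cost q n c Δ k m choice kkΔ≤m = begin
  suc q * n * (suc c * Δ) ^ c * (k * k) ^ c        ≡⟨ cong (λ x → suc q * n * x * (k * k) ^ c) (^-distribʳ-* (suc c) Δ c) ⟩
  suc q * n * (suc c ^ c * Δ ^ c) * (k * k) ^ c    ≡⟨ regroup (suc q * n) (suc c ^ c) (Δ ^ c) ((k * k) ^ c) ⟩
  suc q * n * suc c ^ c * ((k * k) ^ c * Δ ^ c)    ≤⟨ *-monoˡ-≤ ((k * k) ^ c * Δ ^ c) choice ⟩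
  3 ^ c * c ! * ((k * k) ^ c * Δ ^ c)              ≡⟨ regroup′ (3 ^ c) (c !) ((k * k) ^ c) (Δ ^ c) ⟩
  c ! * (3 ^ c * (k * k) ^ c * Δ ^ c)              ≡⟨ cong (λ x → c ! * (x * Δ ^ c)) (^-distribʳ-* 3 (k * k) c) ⟨
  c ! * ((3 * (k * k)) ^ c * Δ ^ c)                ≡⟨ cong (c ! *_) (^-distribʳ-* (3 * (k * k)) Δ c) ⟨
  c ! * (3 * (k * k) * Δ) ^ c                      ≤⟨ *-monoʳ-≤ (c !) (^-monoˡ-≤ c kkΔ≤m) ⟩
  c ! * m ^ c                                      ∎
  where
  regroup : ∀ a s d k → a * (s * d) * k ≡ a * s * (k * d)
  regroup = solve-∀
  regroup′ : ∀ t F k d → t * F * (k * d) ≡ F * (t * k * d)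
  regroup′ = solve-∀

-- For Δ = 0 there are no codes and for k = 0 no lists meet; otherwise m > 0 can be cancelled.
union-bound : ∀ q n c Δ k m → 1 ≤ c → suc c ≤ n →
  suc q * n * suc c ^ c ≤ 3 ^ c * c ! → 3 * (k * k) * Δ ≤ m →
  suc q * (n * ((suc c * Δ) C c)) * ((m C k) ^ (n ∸ suc c) * (m C k) * meetBound m k ^ c) ≤ (m C k) ^ n
union-bound q n (suc c) zero k m _ _ _ _
  rewrite *-zeroʳ (suc (suc c)) | *-zeroʳ n | *-zeroʳ (suc q) = z≤n
union-bound q n c@(suc _) (suc Δ) zero m _ _ _ _
  rewrite *-zeroʳ ((m C 0) ^ (n ∸ suc c) * (m C 0))
        | *-zeroʳ (suc q * (n * ((suc c * suc Δ) C c))) = z≤n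
union-bound q n c (suc Δ) (suc k) zero _ _ _ ()
union-bound q n c Δ k m@(suc _) _ c<n choice kkΔ≤m =
  *-cancelʳ-≤ _ _ (c ! * m ^ c) {{m*n≢0 (c !) (m ^ c) {{c !≢0}} {{m^n≢0 m c}}}} (begin
    suc q * (n * W) * A * (c ! * m ^ c)                   ≡⟨ regroup (suc q) n W A (c !) (m ^ c) ⟩
    suc q * n * (W * c !) * (m ^ c * A)                   ≤⟨ *-mono-≤ (*-monoʳ-≤ (suc q * n) (nCk*k!≤n^k (suc c * Δ) c))
                                                                       (≤-reflexive (edges-cost m k f c)) ⟩
    suc q * n * (suc c * Δ) ^ c * (N ^ (f + suc c) * (k * k) ^ c)
                                                          ≡⟨ cong (λ e → suc q * n * (suc c * Δ) ^ c * (N ^ e * (k * k) ^ c))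
                                                                  (m∸n+n≡m c<n) ⟩
    suc q * n * (suc c * Δ) ^ c * (N ^ n * (k * k) ^ c)   ≡⟨ regroup′ (suc q * n * (suc c * Δ) ^ c) (N ^ n) ((k * k) ^ c) ⟩
    suc q * n * (suc c * Δ) ^ c * (k * k) ^ c * N ^ n     ≤⟨ *-monoˡ-≤ (N ^ n) (codes-cost q n c Δ k m choice kkΔ≤m) ⟩
    c ! * m ^ c * N ^ n                                   ≡⟨ *-comm (c ! * m ^ c) (N ^ n) ⟩
    N ^ n * (c ! * m ^ c)                                 ∎)
  where
  N = m C k
  W = (suc c * Δ) C c
  f = n ∸ suc c
  A = N ^ f * N * meetBound m k ^ c
  regroup : ∀ a n W A F M → a * (n * W) * A * (F * M) ≡ a * n * (W * F) * (M * A)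
  regroup = solve-∀
  regroup′ : ∀ x N k → x * (N * k) ≡ x * k * N
  regroup′ = solve-∀

module BadAssignments {n} (G : Graph n) (k m c : ℕ) where

  open Exploration G

  codes : List (List Bool)
  codes = map toList (combinations (suc c * Δ) c)

  -- Codes that do not record an exploration may decode to degenerate trees; these are discarded.
  candidates : Fin n → Edges n → List (ListAssignment n m)
  candidates v E with ∣ vertices v E ∣ ≟ suc c ×-dec length E ≟ c
  ... | yes _ = alongTree k v (vertices v E) E
  ... | no  _ = []

  decodedCandidates : Fin n × List Bool → List (ListAssignment n m)
  decodedCandidates (v , w) = candidates v (proj₂ (decode (suc c) w ([ v ] , [])))

  Bad : List (ListAssignment n m)
  Bad = concatMap decodedCandidates (cartesianProduct (allFin n) codes)

  length-Bad-≤ : ∀ {b} → (∀ v E → length (candidates v E) ≤ b) →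
                 length Bad ≤ n * ((suc c * Δ) C c) * b
  length-Bad-≤ {b} candidates≤b = begin
    length Bad                 ≤⟨ length-concatMap-≤ decodedCandidates items
                                    (λ {(v , w)} _ → candidates≤b v (proj₂ (decode (suc c) w ([ v ] , [])))) ⟩
    length items * b           ≡⟨ cong (_* b) #items ⟩
    n * ((suc c * Δ) C c) * b  ∎
    where
    items = cartesianProduct (allFin n) codes
    #items : length items ≡ n * ((suc c * Δ) C c)
    #items = trans (length-cartesianProductWith _,_ (allFin n) codes)
                   (cong₂ _*_ (length-tabulate {n = n} (λ i → i))
                              (trans (length-map toList (combinations (suc c * Δ) c))
                                     (length-combinations (suc c * Δ) c)))

  length-candidates : suc c ≤ n → ∀ v E →
    length (candidates v E) ≤ (m C k) ^ (n ∸ suc c) * (m C k) * meetBound m k ^ c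
  length-candidates _ v E with ∣ vertices v E ∣ ≟ suc c ×-dec length E ≟ c
  ... | yes (size , refl) =
    subst (λ f → length (alongTree k v (vertices v E) E) ≤ (m C k) ^ f * (m C k) * meetBound m k ^ length E)
          (trans (∣∁p∣≡n∸∣p∣ (vertices v E)) (cong (n ∸_) size))
          (length-alongTree k v (vertices v E) E)
  ... | no  _ = z≤n

  no-candidates : ¬ (suc c ≤ n) → ∀ v E → length (candidates v E) ≤ 0
  no-candidates c≮n v E with ∣ vertices v E ∣ ≟ suc c ×-dec length E ≟ c
  ... | yes (size , _) = contradiction (subst (_≤ n) size (∣p∣≤n (vertices v E))) c≮n
  ... | no  _ = z≤n

  Bad-rare : ∀ q → 1 ≤ c → suc q * n * suc c ^ c ≤ 3 ^ c * c ! → 3 * (k * k) * Δ ≤ m →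
             suc q * length Bad ≤ (m C k) ^ n
  Bad-rare q 1≤c choice kkΔ≤m with suc c ≤? n
  ... | yes c<n = begin
    suc q * length Bad  ≤⟨ *-monoʳ-≤ (suc q) (length-Bad-≤ (length-candidates c<n)) ⟩
    suc q * (n * ((suc c * Δ) C c) * A₀)
                        ≡⟨ sym (*-assoc (suc q) (n * ((suc c * Δ) C c)) A₀) ⟩
    suc q * (n * ((suc c * Δ) C c)) * A₀
                        ≤⟨ union-bound q n c Δ k m 1≤c c<n choice kkΔ≤m ⟩
    (m C k) ^ n         ∎
    where A₀ = (m C k) ^ (n ∸ suc c) * (m C k) * meetBound m k ^ c
  ... | no  c≮n = begin
    suc q * length Bad  ≤⟨ *-monoʳ-≤ (suc q) (length-Bad-≤ (no-candidates c≮n)) ⟩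
    suc q * (n * ((suc c * Δ) C c) * 0) ≡⟨ cong (suc q *_) (*-zeroʳ (n * ((suc c * Δ) C c))) ⟩
    suc q * 0           ≡⟨ *-zeroʳ (suc q) ⟩
    0                   ≤⟨ z≤n ⟩
    (m C k) ^ n         ∎

  ∈-candidates : ∀ {L v E} → IsKList k L → MeetingTree L v E → length E ≡ c → L ∈ candidates v E
  ∈-candidates {L} {v} {E} kl tree |E|≡c with ∣ vertices v E ∣ ≟ suc c ×-dec length E ≟ c
  ... | yes _     = subst (_∈ alongTree k v (vertices v E) E) (hide-all k (vertices v E) L)
                          (∈-alongTree k (vertices v E) kl tree)
  ... | no ¬valid = contradiction (trans (∣vertices∣ L v tree) (cong suc |E|≡c) , |E|≡c) ¬valid

  ∈-codes : ∀ w → length w ≡ suc c * Δ → trues w ≡ c → w ∈ codes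
  ∈-codes w length≡ trues≡ = subst₂ (λ N t → w ∈ map toList (combinations N t)) length≡ trues≡
    (subst (_∈ map toList (combinations (length w) (trues w))) (toList∘fromList w)
      (∈-map⁺ toList (∈-combinations (fromList w))))

  module Outcome (L : ListAssignment n m) (v : Fin n) where

    open Encoding L c v

    run : List Bool × State
    run = explore (suc c) ([ v ] , [])

    bits : List Bool
    bits = proj₁ run

    E : Edges n
    E = proj₂ (proj₂ run)

    inv : Invariant 0 (proj₁ (proj₂ run)) E
    inv = explore-invariant (suc c) invariant₀

    padding : List Bool
    padding = replicate (suc c * Δ ∸ length bits) false

    code : List Bool
    code = bits ++ padding

    decode-code : proj₂ (decode (suc c) code ([ v ] , [])) ≡ E
    decode-code = cong proj₂ (decode-explore (suc c) ([ v ] , []) padding)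

    length-code : length code ≡ suc c * Δ
    length-code = begin-equality
      length code                              ≡⟨ length-++ bits ⟩
      length bits + length padding             ≡⟨ cong (length bits +_) (length-replicate (suc c * Δ ∸ length bits)) ⟩
      length bits + (suc c * Δ ∸ length bits)  ≡⟨ m+[n∸m]≡n (length-explore (suc c) ([ v ] , [])) ⟩
      suc c * Δ                                ∎

    trues-code : trues code ≡ length E
    trues-code = begin-equality
      trues code                  ≡⟨ trues-++ bits padding ⟩
      trues bits + trues padding  ≡⟨ cong (trues bits +_) (trues-replicate-false (suc c * Δ ∸ length bits)) ⟩
      trues bits + 0              ≡⟨ trues-explore (suc c) [ v ] [] ⟩
      length E                    ∎

    L∈Bad : IsKList k L → length E ≡ c → L ∈ Bad
    L∈Bad kl |E|≡c = ∈-concatMap⁺ decodedCandidates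
      (lose (∈-cartesianProduct⁺ (∈-allFin v) (∈-codes code length-code (trans trues-code |E|≡c)))
            (subst (λ E′ → L ∈ candidates v E′) (sym decode-code) (∈-candidates kl (Invariant.tree inv) |E|≡c)))

    component⊆vertices : length E < c → ∀ {a u} → a ∈ₛ vertices v E → Reach G L a u → u ∈ₛ vertices v E
    component⊆vertices |E|<c a∈ here         = a∈
    component⊆vertices |E|<c a∈ (step aw∈B r) with finished-closed inv a∈ aw∈B
    ... | inj₁ w∈     = component⊆vertices |E|<c w∈ r
    ... | inj₂ c≤|E| = contradiction |E|<c (≤⇒≯ c≤|E|)

    ∣component∣≤c : length E < c → (S : Subset n) → (∀ u → u ∈ₛ S → Reach G L v u) → ∣ S ∣ ≤ c
    ∣component∣≤c |E|<c S S⊆B[v] = begin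
      ∣ S ∣              ≤⟨ p⊆q⇒∣p∣≤∣q∣ S⊆vertices ⟩
      ∣ vertices v E ∣   ≡⟨ ∣vertices∣ L v (Invariant.tree inv) ⟩
      suc (length E)     ≤⟨ |E|<c ⟩
      c                  ∎
      where
      S⊆vertices : S ⊆ vertices v E
      S⊆vertices {u} u∈S = component⊆vertices |E|<c (root∈vertices E) (S⊆B[v] u u∈S)

  ∉Bad⇒componentsSmall : ExpLe c (n ^ 20) → ∀ L → IsKList k L → L ∉ Bad → ComponentsSmall G L
  ∉Bad⇒componentsSmall e^c≤n^20 L kl L∉Bad v S S⊆B[v] with length (Outcome.E L v) ≟ c
  ... | yes |E|≡c = contradiction (Outcome.L∈Bad L v kl |E|≡c) L∉Bad
  ... | no  |E|≢c = expLe-mono {N = n ^ 20}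
    (Outcome.∣component∣≤c L v (≤∧≢⇒< (Invariant.budget (Outcome.inv L v)) |E|≢c) S S⊆B[v]) e^c≤n^20
    where open Encoding L c v using (Invariant)

lemma2p1 : ∀ (q : ℕ) → ∃[ N ] ∀ n → N ≤ n → (G : Graph n) → ∀ k m →
             3 * (k * k) * maxDegree G ≤ m →
             Σ (List (ListAssignment n m)) λ Bad →
               (suc q * length Bad ≤ (m C k) ^ n) ×
               (∀ L → IsKList k L → L ∉ Bad → ComponentsSmall G L)
lemma2p1 q = proj₁ (choose q) , λ n N≤n G k m kkΔ≤m →
  let c , 1≤c , choice , e^c≤n^20 = proj₂ (choose q) n N≤n
      open BadAssignments G k m c
  in Bad , Bad-rare q 1≤c choice kkΔ≤m , ∉Bad⇒componentsSmall e^c≤n^20
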